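{- Let $Q_{2,1}=\mathrm{conv}\{(0,0),(a,b),(c,d)\}$ and $Q_{2,2}=\mathrm{conv}\{(0,0),(a',b'),(c',d')\}$ be integral $2$-simplices in $\mathbb{R}^2$. For $n>2$ let $$Q_{n,1}=\mathrm{conv}\{\mathbf{0},(a,b,0,\dots,0),(c,d,0,\dots,0),\mathbf{e_3},\dots,\mathbf{e_n}\},\quad Q_{n,2}=\mathrm{conv}\{\mathbf{0},(a',b',0,\dots,0),(c',d',0,\dots,0),\mathbf{e_3},\dots,\mathbf{e_n}\}\subset\mathbb{R}^n,$$ where $\mathbf{e_i}$ are the standard basis vectors. Then $Q_{2,1}$ and $Q_{2,2}$ are unimodularly equivalent if and only if $Q_{n,1}$ and $Q_{n,2}$ are unimodularly equivalent.
   Context: An integral $2$-simplex is a (nondegenerate) triangle with vertices in $\mathbb{Z}^2$; here $a,b,c,d,a',b',c',d'\in\mathbb{Z}$. Two polytopes $P,Q\subset\mathbb{R}^m$ are unimodularly equivalent if there exist $B\in\operatorname{GL}_m(\mathbb{Z})$ and $\mathbf{c}\in\mathbb{Z}^m$ with $\{B\mathbf{v}+\mathbf{c}:\mathbf{v}\in P\}=Q$.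
   Formalization: The polytopes, and the set equality defining unimodular equivalence, consist only of points with rational coordinates, lying in ℚ^2 and ℚ^n rather than ℝ^2 and ℝ^n. -}

module Defs where

open import Data.Nat as ℕ using (ℕ; zero; suc)
open import Data.Integer as ℤ using (ℤ)
open import Data.Rational as ℚ using (ℚ; 0ℚ; 1ℚ; _/_)
open import Data.Fin using (Fin; zero; suc; toℕ)
open import Data.Product using (Σ; ∃; _×_; _,_)
open import Function.Bundles using (_⇔_)
open import Relation.Binary.PropositionalEquality using (_≡_)
open import Relation.Nullary using (¬_)

-- Points of ℚ^m (rational points of ℝ^m)
Point : ℕ → Set
Point m = Fin m → ℚ

Mat : ℕ → Set
Mat m = Fin m → Fin m → ℤ

Σℚ : ∀ {k} → (Fin k → ℚ) → ℚ
Σℚ {zero}  f = 0ℚ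
Σℚ {suc k} f = f zero ℚ.+ Σℚ (λ i → f (suc i))

Σℤ : ∀ {k} → (Fin k → ℤ) → ℤ
Σℤ {zero}  f = ℤ.+ 0
Σℤ {suc k} f = f zero ℤ.+ Σℤ (λ i → f (suc i))

ℤtoℚ : ℤ → ℚ
ℤtoℚ z = z / 1

_⊗_ : ∀ {m} → Mat m → Mat m → Mat m
(A ⊗ B) i j = Σℤ (λ l → A i l ℤ.* B l j)

I : ∀ {m} → Mat m
I i j with toℕ i ℕ.≟ toℕ j
... | Relation.Nullary.yes _ = ℤ.+ 1
... | Relation.Nullary.no  _ = ℤ.+ 0

InGL : ∀ {m} → Mat m → Set
InGL {m} B = Σ (Mat m) λ C → (∀ i j → (B ⊗ C) i j ≡ I i j) × (∀ i j → (C ⊗ B) i j ≡ I i j)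

affine : ∀ {m} → Mat m → (Fin m → ℤ) → Point m → Point m
affine B c v i = Σℚ (λ j → ℤtoℚ (B i j) ℚ.* v j) ℚ.+ ℤtoℚ (c i)

Region : ℕ → Set₁
Region m = Point m → Set

conv : ∀ {m k} → (Fin k → Point m) → Region m
conv {m} {k} V x =
  Σ (Fin k → ℚ) λ λs →
    (∀ i → 0ℚ ℚ.≤ λs i) × (Σℚ λs ≡ 1ℚ) ×
    (∀ j → x j ≡ Σℚ (λ i → λs i ℚ.* V i j))

UnimodEquiv : ∀ {m} → Region m → Region m → Set
UnimodEquiv {m} P Q =
  Σ (Mat m) λ B → Σ (Fin m → ℤ) λ c → InGL B ×
    (∀ y → Q y ⇔ (Σ (Point m) λ v → P v × (∀ i → affine B c v i ≡ y i)))

-- vertex (as ℕ index) and coordinate (as ℕ index) of Q_n: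
-- vertex 0 = 0, vertex 1 = (a,b,0,…), vertex 2 = (c,d,0,…),
-- vertex v ≥ 3 = e_{v} in 1-indexed notation, i.e. coordinate v-1 (0-indexed) is 1.
vertexCoord : ℤ → ℤ → ℤ → ℤ → ℕ → ℕ → ℚ
vertexCoord a b c d 0 j = 0ℚ
vertexCoord a b c d 1 0 = ℤtoℚ a
vertexCoord a b c d 1 1 = ℤtoℚ b
vertexCoord a b c d 1 (suc (suc j)) = 0ℚ
vertexCoord a b c d 2 0 = ℤtoℚ c
vertexCoord a b c d 2 1 = ℤtoℚ d
vertexCoord a b c d 2 (suc (suc j)) = 0ℚ
vertexCoord a b c d (suc (suc (suc v))) j with j ℕ.≟ suc (suc v)
... | Relation.Nullary.yes _ = 1ℚ
... | Relation.Nullary.no  _ = 0ℚ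

Qverts : (n : ℕ) → ℤ → ℤ → ℤ → ℤ → Fin (suc n) → Point n
Qverts n a b c d v j = vertexCoord a b c d (toℕ v) (toℕ j)

Qpoly : (n : ℕ) → ℤ → ℤ → ℤ → ℤ → Region n
Qpoly n a b c d = conv (Qverts n a b c d)

Nondeg : ℤ → ℤ → ℤ → ℤ → Set
Nondeg a b c d = ¬ (a ℤ.* d ℤ.- b ℤ.* c ≡ ℤ.+ 0)

-- A unimodular map x ↦ M x + c of the plane carrying one triangle onto the other extends to a
-- unimodular map of ℤⁿ that acts as x ↦ M x + c on the plane and fixes e₃, …, eₙ, and this map
-- carries Qₙ onto Q′ₙ.
--
-- Conversely, a unimodular map Qₙ → Q′ₙ sends the corners 0, (a, b), (c, d), which are extreme because
-- D = ad − bc ≠ 0, to three distinct vertices of Q′ₙ. If all three land in the plane, the lower-left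
-- block of the map vanishes and its top-left block is a unimodular map of the plane carrying one
-- triangle onto the other. Otherwise some corner is sent to a basis vector eᵢ; the i-th coordinate of
-- the map is then an integral affine functional equal to 1 at that corner and to 0 at the other two, so
-- the triangle is equivalent to S(|D|) = conv{0, (|D|, 0), (0, 1)}, and its opposite edge, which is D
-- times a lattice vector, is mapped onto an edge of Q′ₙ, whence D divides D′ = a′d′ − b′c′. Applying
-- this to the map and to its inverse, either one of them restricts to the plane, or |D| = |D′| and
-- both triangles are equivalent to S(|D|).

module Submission where

open import Defs
open import Data.Nat using (ℕ; _<_)
open import Data.Nat using (zero; suc; _+_)
open import Data.Integer using (ℤ)
open import Function.Bundles using (_⇔_)

open import Algebra.Bundles using (Ring)
import Algebra.Properties.Semiring.Sum as SemiringSum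
open import Data.Empty using (⊥-elim)
open import Data.Integer.Divisibility.Signed using (_∣_; divides; ∣m∣n⇒∣m+n; ∣n⇒∣m*n; ∣m⇒∣-m; ∣⇒∣ᵤ)
open import Data.Fin as Fin using (Fin; zero; suc; toℕ; _↑ˡ_; _↑ʳ_)
import Data.Fin.Properties as FinP
open import Data.Integer as ℤ using (0ℤ; 1ℤ; -1ℤ)
import Data.Integer.Properties as ℤP
open import Data.Integer.Solver using (module +-*-Solver)
open import Data.Integer.Tactic.RingSolver using (solve-∀)
import Data.Nat as ℕ
import Data.Nat.Properties as ℕP
import Data.Nat.Divisibility as ℕ∣
open import Data.Product using (Σ; ∃; ∃₂; _×_; _,_; proj₁; proj₂)
open import Data.Rational as ℚ using (ℚ; 0ℚ; 1ℚ)
import Data.Rational.Properties as ℚP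
import Data.Rational.Solver as ℚSolver
import Data.Rational.Unnormalised as ℚᵘ
import Data.Rational.Unnormalised.Properties as ℚᵘP
open import Data.Sum as Sum using (_⊎_; inj₁; inj₂)
open import Function.Bundles using (Equivalence; mk⇔)
open import Relation.Binary.PropositionalEquality
open import Relation.Binary.Definitions using (tri<; tri≈; tri>)
open import Relation.Nullary using (¬_; yes; no)

-- Finite sums and the identity matrix

ℤtoℚ-toℚᵘ : ∀ x → ℚ.toℚᵘ (ℤtoℚ x) ℚᵘ.≃ ℚᵘ.mkℚᵘ x 0
ℤtoℚ-toℚᵘ x = ℚP.toℚᵘ-fromℚᵘ (ℚᵘ.mkℚᵘ x 0)

ℤtoℚ-homo-+ : ∀ x y → ℤtoℚ (x ℤ.+ y) ≡ ℤtoℚ x ℚ.+ ℤtoℚ y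
ℤtoℚ-homo-+ x y = ℚP.toℚᵘ-injective (begin
  ℚ.toℚᵘ (ℤtoℚ (x ℤ.+ y))               ≈⟨ ℤtoℚ-toℚᵘ (x ℤ.+ y) ⟩
  ℚᵘ.mkℚᵘ (x ℤ.+ y) 0                    ≈⟨ ℚᵘ.*≡* (cross-multiplied x y) ⟩
  ℚᵘ.mkℚᵘ x 0 ℚᵘ.+ ℚᵘ.mkℚᵘ y 0           ≈⟨ ℚᵘP.+-cong (ℤtoℚ-toℚᵘ x) (ℤtoℚ-toℚᵘ y) ⟨
  ℚ.toℚᵘ (ℤtoℚ x) ℚᵘ.+ ℚ.toℚᵘ (ℤtoℚ y)  ≈⟨ ℚP.toℚᵘ-homo-+ (ℤtoℚ x) (ℤtoℚ y) ⟨
  ℚ.toℚᵘ (ℤtoℚ x ℚ.+ ℤtoℚ y)             ∎)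
  where
  open ℚᵘP.≃-Reasoning
  cross-multiplied : ∀ x y → (x ℤ.+ y) ℤ.* 1ℤ ≡ (x ℤ.* 1ℤ ℤ.+ y ℤ.* 1ℤ) ℤ.* 1ℤ
  cross-multiplied = solve-∀

ℤtoℚ-homo-* : ∀ x y → ℤtoℚ (x ℤ.* y) ≡ ℤtoℚ x ℚ.* ℤtoℚ y
ℤtoℚ-homo-* x y = ℚP.toℚᵘ-injective (begin
  ℚ.toℚᵘ (ℤtoℚ (x ℤ.* y))               ≈⟨ ℤtoℚ-toℚᵘ (x ℤ.* y) ⟩
  ℚᵘ.mkℚᵘ (x ℤ.* y) 0                    ≈⟨ ℚᵘP.*-cong (ℤtoℚ-toℚᵘ x) (ℤtoℚ-toℚᵘ y) ⟨
  ℚ.toℚᵘ (ℤtoℚ x) ℚᵘ.* ℚ.toℚᵘ (ℤtoℚ y)  ≈⟨ ℚP.toℚᵘ-homo-* (ℤtoℚ x) (ℤtoℚ y) ⟨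
  ℚ.toℚᵘ (ℤtoℚ x ℚ.* ℤtoℚ y)             ∎)
  where open ℚᵘP.≃-Reasoning

ℤtoℚ-homo‿- : ∀ x → ℤtoℚ (ℤ.- x) ≡ ℚ.- ℤtoℚ x
ℤtoℚ-homo‿- x = ℚP.toℚᵘ-injective (begin
  ℚ.toℚᵘ (ℤtoℚ (ℤ.- x))    ≈⟨ ℤtoℚ-toℚᵘ (ℤ.- x) ⟩
  ℚᵘ.mkℚᵘ (ℤ.- x) 0        ≈⟨ ℚᵘP.-‿cong (ℤtoℚ-toℚᵘ x) ⟨
  ℚᵘ.- ℚ.toℚᵘ (ℤtoℚ x)     ≈⟨ ℚP.toℚᵘ-homo‿- (ℤtoℚ x) ⟨
  ℚ.toℚᵘ (ℚ.- ℤtoℚ x)      ∎)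
  where open ℚᵘP.≃-Reasoning

ℤtoℚ-injective : ∀ {x y} → ℤtoℚ x ≡ ℤtoℚ y → x ≡ y
ℤtoℚ-injective {x} {y} eq with ℚᵘP.≃-trans (ℚᵘP.≃-sym (ℤtoℚ-toℚᵘ x))
                               (ℚᵘP.≃-trans (ℚᵘP.≃-reflexive (cong ℚ.toℚᵘ eq)) (ℤtoℚ-toℚᵘ y))
... | ℚᵘ.*≡* x*1≡y*1 = trans (sym (ℤP.*-identityʳ x)) (trans x*1≡y*1 (ℤP.*-identityʳ y))

private
  module ℚΣ = SemiringSum (Ring.semiring ℚP.+-*-ring)
  module ℤΣ = SemiringSum ℤP.+-*-semiring

Σℚ≡sum : ∀ {k} (f : Fin k → ℚ) → Σℚ f ≡ ℚΣ.sum f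
Σℚ≡sum {zero}  f = refl
Σℚ≡sum {suc k} f = cong (f zero ℚ.+_) (Σℚ≡sum (λ i → f (suc i)))

Σℤ≡sum : ∀ {k} (f : Fin k → ℤ) → Σℤ f ≡ ℤΣ.sum f
Σℤ≡sum {zero}  f = refl
Σℤ≡sum {suc k} f = cong (ℤ._+_ (f zero)) (Σℤ≡sum (λ i → f (suc i)))

Σℚ-cong : ∀ {k} {f g : Fin k → ℚ} → f ≗ g → Σℚ f ≡ Σℚ g
Σℚ-cong {zero}  f≗g = refl
Σℚ-cong {suc k} f≗g = cong₂ ℚ._+_ (f≗g zero) (Σℚ-cong (λ i → f≗g (suc i)))

Σℤ-cong : ∀ {k} {f g : Fin k → ℤ} → f ≗ g → Σℤ f ≡ Σℤ g
Σℤ-cong {zero}  f≗g = refl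
Σℤ-cong {suc k} f≗g = cong₂ ℤ._+_ (f≗g zero) (Σℤ-cong (λ i → f≗g (suc i)))

Σℚ-zero : ∀ {k} {f : Fin k → ℚ} → (∀ i → f i ≡ 0ℚ) → Σℚ f ≡ 0ℚ
Σℚ-zero {zero}  f≡0 = refl
Σℚ-zero {suc k} f≡0 = cong₂ ℚ._+_ (f≡0 zero) (Σℚ-zero (λ i → f≡0 (suc i)))

Σℤ-zero : ∀ {k} {f : Fin k → ℤ} → (∀ i → f i ≡ 0ℤ) → Σℤ f ≡ 0ℤ
Σℤ-zero {zero}  f≡0 = refl
Σℤ-zero {suc k} f≡0 = cong₂ ℤ._+_ (f≡0 zero) (Σℤ-zero (λ i → f≡0 (suc i)))

Σℚ-distrib-+ : ∀ {k} (f g : Fin k → ℚ) → Σℚ (λ i → f i ℚ.+ g i) ≡ Σℚ f ℚ.+ Σℚ g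
Σℚ-distrib-+ f g = begin
  Σℚ (λ i → f i ℚ.+ g i)      ≡⟨ Σℚ≡sum (λ i → f i ℚ.+ g i) ⟩
  ℚΣ.sum (λ i → f i ℚ.+ g i)  ≡⟨ ℚΣ.∑-distrib-+ f g ⟩
  ℚΣ.sum f ℚ.+ ℚΣ.sum g       ≡⟨ cong₂ ℚ._+_ (Σℚ≡sum f) (Σℚ≡sum g) ⟨
  Σℚ f ℚ.+ Σℚ g               ∎
  where open ≡-Reasoning

Σℚ-*ˡ : ∀ {k} x (f : Fin k → ℚ) → Σℚ (λ i → x ℚ.* f i) ≡ x ℚ.* Σℚ f
Σℚ-*ˡ x f = begin
  Σℚ (λ i → x ℚ.* f i)      ≡⟨ Σℚ≡sum (λ i → x ℚ.* f i) ⟩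
  ℚΣ.sum (λ i → x ℚ.* f i)  ≡⟨ ℚΣ.*-distribˡ-sum x f ⟨
  x ℚ.* ℚΣ.sum f            ≡⟨ cong (x ℚ.*_) (Σℚ≡sum f) ⟨
  x ℚ.* Σℚ f                ∎
  where open ≡-Reasoning

Σℤ-*ˡ : ∀ {k} x (f : Fin k → ℤ) → Σℤ (λ i → x ℤ.* f i) ≡ x ℤ.* Σℤ f
Σℤ-*ˡ x f = begin
  Σℤ (λ i → x ℤ.* f i)      ≡⟨ Σℤ≡sum (λ i → x ℤ.* f i) ⟩
  ℤΣ.sum (λ i → x ℤ.* f i)  ≡⟨ ℤΣ.*-distribˡ-sum x f ⟨
  x ℤ.* ℤΣ.sum f            ≡⟨ cong (x ℤ.*_) (Σℤ≡sum f) ⟨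
  x ℤ.* Σℤ f                ∎
  where open ≡-Reasoning

Σℚ-*ʳ : ∀ {k} x (f : Fin k → ℚ) → Σℚ (λ i → f i ℚ.* x) ≡ Σℚ f ℚ.* x
Σℚ-*ʳ x f = begin
  Σℚ (λ i → f i ℚ.* x)      ≡⟨ Σℚ≡sum (λ i → f i ℚ.* x) ⟩
  ℚΣ.sum (λ i → f i ℚ.* x)  ≡⟨ ℚΣ.*-distribʳ-sum x f ⟨
  ℚΣ.sum f ℚ.* x            ≡⟨ cong (ℚ._* x) (Σℚ≡sum f) ⟨
  Σℚ f ℚ.* x                ∎
  where open ≡-Reasoning

Σℤ-*ʳ : ∀ {k} x (f : Fin k → ℤ) → Σℤ (λ i → f i ℤ.* x) ≡ Σℤ f ℤ.* x
Σℤ-*ʳ x f = begin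
  Σℤ (λ i → f i ℤ.* x)      ≡⟨ Σℤ≡sum (λ i → f i ℤ.* x) ⟩
  ℤΣ.sum (λ i → f i ℤ.* x)  ≡⟨ ℤΣ.*-distribʳ-sum x f ⟨
  ℤΣ.sum f ℤ.* x            ≡⟨ cong (ℤ._* x) (Σℤ≡sum f) ⟨
  Σℤ f ℤ.* x                ∎
  where open ≡-Reasoning

Σℚ-comm : ∀ {k l} (f : Fin k → Fin l → ℚ) →
          Σℚ (λ i → Σℚ (λ j → f i j)) ≡ Σℚ (λ j → Σℚ (λ i → f i j))
Σℚ-comm f = begin
  Σℚ (λ i → Σℚ (f i))                          ≡⟨ double-sum f ⟩
  ℚΣ.sum (λ i → ℚΣ.sum (f i))                  ≡⟨ ℚΣ.∑-comm f ⟩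
  ℚΣ.sum (λ j → ℚΣ.sum (λ i → f i j))          ≡⟨ double-sum (λ j i → f i j) ⟨
  Σℚ (λ j → Σℚ (λ i → f i j))                  ∎
  where
  open ≡-Reasoning
  double-sum : ∀ {k l} (g : Fin k → Fin l → ℚ) → Σℚ (λ i → Σℚ (g i)) ≡ ℚΣ.sum (λ i → ℚΣ.sum (g i))
  double-sum g = trans (Σℚ≡sum (λ i → Σℚ (g i))) (ℚΣ.sum-cong-≗ (λ i → Σℚ≡sum (g i)))

Σℤ-comm : ∀ {k l} (f : Fin k → Fin l → ℤ) →
          Σℤ (λ i → Σℤ (λ j → f i j)) ≡ Σℤ (λ j → Σℤ (λ i → f i j))
Σℤ-comm f = begin
  Σℤ (λ i → Σℤ (f i))                          ≡⟨ double-sum f ⟩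
  ℤΣ.sum (λ i → ℤΣ.sum (f i))                  ≡⟨ ℤΣ.∑-comm f ⟩
  ℤΣ.sum (λ j → ℤΣ.sum (λ i → f i j))          ≡⟨ double-sum (λ j i → f i j) ⟨
  Σℤ (λ j → Σℤ (λ i → f i j))                  ∎
  where
  open ≡-Reasoning
  double-sum : ∀ {k l} (g : Fin k → Fin l → ℤ) → Σℤ (λ i → Σℤ (g i)) ≡ ℤΣ.sum (λ i → ℤΣ.sum (g i))
  double-sum g = trans (Σℤ≡sum (λ i → Σℤ (g i))) (ℤΣ.sum-cong-≗ (λ i → Σℤ≡sum (g i)))

Σℤ-neg : ∀ {k} (f : Fin k → ℤ) → Σℤ (λ i → ℤ.- f i) ≡ ℤ.- Σℤ f
Σℤ-neg {zero}  f = refl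
Σℤ-neg {suc k} f = trans (cong (ℤ._+_ (ℤ.- f zero)) (Σℤ-neg (λ i → f (suc i)))) (sym (ℤP.neg-distrib-+ (f zero) _))

ℤtoℚ-homo-Σ : ∀ {k} (f : Fin k → ℤ) → ℤtoℚ (Σℤ f) ≡ Σℚ (λ i → ℤtoℚ (f i))
ℤtoℚ-homo-Σ {zero}  f = refl
ℤtoℚ-homo-Σ {suc k} f =
  trans (ℤtoℚ-homo-+ (f zero) _) (cong (ℤtoℚ (f zero) ℚ.+_) (ℤtoℚ-homo-Σ (λ i → f (suc i))))

Σℚ-nonneg : ∀ {k} {f : Fin k → ℚ} → (∀ i → 0ℚ ℚ.≤ f i) → 0ℚ ℚ.≤ Σℚ f
Σℚ-nonneg {zero}  f≥0 = ℚP.≤-refl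
Σℚ-nonneg {suc k} f≥0 = ℚP.+-mono-≤ (f≥0 zero) (Σℚ-nonneg (λ i → f≥0 (suc i)))

Σℚ-mono-≤ : ∀ {k} {f g : Fin k → ℚ} → (∀ i → f i ℚ.≤ g i) → Σℚ f ℚ.≤ Σℚ g
Σℚ-mono-≤ {zero}  f≤g = ℚP.≤-refl
Σℚ-mono-≤ {suc k} f≤g = ℚP.+-mono-≤ (f≤g zero) (Σℚ-mono-≤ (λ i → f≤g (suc i)))

Σℚ-single-≤ : ∀ {k} {f : Fin k → ℚ} → (∀ i → 0ℚ ℚ.≤ f i) → ∀ s → f s ℚ.≤ Σℚ f
Σℚ-single-≤ {suc k} {f} f≥0 zero =
  subst (ℚ._≤ Σℚ f) (ℚP.+-identityʳ (f zero)) (ℚP.+-monoʳ-≤ (f zero) (Σℚ-nonneg (λ i → f≥0 (suc i))))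
Σℚ-single-≤ {suc k} {f} f≥0 (suc s) =
  ℚP.≤-trans (Σℚ-single-≤ (λ i → f≥0 (suc i)) s)
    (subst (ℚ._≤ Σℚ f) (ℚP.+-identityˡ (Σℚ (λ i → f (suc i)))) (ℚP.+-monoˡ-≤ (Σℚ (λ i → f (suc i))) (f≥0 zero)))

≤-+-equal : ∀ {a b c d} → a ℚ.≤ b → c ℚ.≤ d → a ℚ.+ c ≡ b ℚ.+ d → a ≡ b
≤-+-equal {a} {b} a≤b c≤d a+c≡b+d with ℚP.<-cmp a b
... | tri< a<b _ _ = ⊥-elim (ℚP.<⇒≢ (ℚP.+-mono-<-≤ a<b c≤d) a+c≡b+d)
... | tri≈ _ a≡b _ = a≡b
... | tri> _ _ b<a = ℚP.≤-antisym a≤b (ℚP.<⇒≤ b<a)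

Σℚ-≤-equal : ∀ {k} {f g : Fin k → ℚ} → (∀ i → f i ℚ.≤ g i) → Σℚ f ≡ Σℚ g → f ≗ g
Σℚ-≤-equal {suc k} f≤g Σf≡Σg zero = ≤-+-equal (f≤g zero) (Σℚ-mono-≤ (λ i → f≤g (suc i))) Σf≡Σg
Σℚ-≤-equal {suc k} {f} {g} f≤g Σf≡Σg (suc i) = Σℚ-≤-equal (λ i → f≤g (suc i)) tails-equal i
  where
  tails-equal : Σℚ (λ i → f (suc i)) ≡ Σℚ (λ i → g (suc i))
  tails-equal = ≤-+-equal (Σℚ-mono-≤ (λ i → f≤g (suc i))) (f≤g zero)
    (trans (ℚP.+-comm _ (f zero)) (trans Σf≡Σg (ℚP.+-comm (g zero) _)))

Σℚ-nonzero : ∀ {k} (f : Fin k → ℚ) → Σℚ f ≢ 0ℚ → ∃ λ i → f i ≢ 0ℚ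
Σℚ-nonzero {zero}  f Σf≢0 = ⊥-elim (Σf≢0 refl)
Σℚ-nonzero {suc k} f Σf≢0 with f zero ℚP.≟ 0ℚ
... | no f₀≢0 = zero , f₀≢0
... | yes f₀≡0 with Σℚ-nonzero (λ i → f (suc i)) (λ Σ≡0 → Σf≢0 (cong₂ ℚ._+_ f₀≡0 Σ≡0))
...   | i , fᵢ≢0 = suc i , fᵢ≢0

*-nonneg : ∀ {p q} → 0ℚ ℚ.≤ p → 0ℚ ℚ.≤ q → 0ℚ ℚ.≤ p ℚ.* q
*-nonneg {p} {q} p≥0 q≥0 =
  ℚP.nonNegative⁻¹ _ {{ℚP.nonNeg*nonNeg⇒nonNeg p {{ℚ.nonNegative p≥0}} q {{ℚ.nonNegative q≥0}}}}

*-cancelˡ-≡ : ∀ {p x y} → p ≢ 0ℚ → p ℚ.* x ≡ p ℚ.* y → x ≡ y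
*-cancelˡ-≡ {p} {x} {y} p≢0 px≡py = begin
  x                      ≡⟨ divide x ⟨
  ℚ.1/ p ℚ.* (p ℚ.* x)   ≡⟨ cong (ℚ.1/ p ℚ.*_) px≡py ⟩
  ℚ.1/ p ℚ.* (p ℚ.* y)   ≡⟨ divide y ⟩
  y                      ∎
  where
  open ≡-Reasoning
  instance _ = ℚ.≢-nonZero p≢0
  divide : ∀ z → ℚ.1/ p ℚ.* (p ℚ.* z) ≡ z
  divide z = trans (sym (ℚP.*-assoc (ℚ.1/ p) p z)) (trans (cong (ℚ._* z) (ℚP.*-inverseˡ p)) (ℚP.*-identityˡ z))

I-diag : ∀ {m} (i : Fin m) → I i i ≡ 1ℤ
I-diag i with toℕ i ℕ.≟ toℕ i
... | yes _ = refl
... | no i≢i = ⊥-elim (i≢i refl)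

I-offdiag : ∀ {m} {i j : Fin m} → i ≢ j → I i j ≡ 0ℤ
I-offdiag {i = i} {j} i≢j with toℕ i ℕ.≟ toℕ j
... | yes i≡j = ⊥-elim (i≢j (FinP.toℕ-injective i≡j))
... | no _ = refl

I-suc : ∀ {m} (i j : Fin m) → I (suc i) (suc j) ≡ I i j
I-suc i j with i FinP.≟ j
... | yes refl = trans (I-diag (suc i)) (sym (I-diag i))
... | no i≢j = trans (I-offdiag (λ eq → i≢j (FinP.suc-injective eq))) (sym (I-offdiag i≢j))

I-sym : ∀ {m} (i j : Fin m) → I i j ≡ I j i
I-sym i j with i FinP.≟ j
... | yes refl = refl
... | no i≢j = trans (I-offdiag i≢j) (sym (I-offdiag (λ j≡i → i≢j (sym j≡i))))

I-↑ˡ : ∀ {m} n (i j : Fin m) → I (i ↑ˡ n) (j ↑ˡ n) ≡ I i j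
I-↑ˡ n i j with i FinP.≟ j
... | yes refl = trans (I-diag (i ↑ˡ n)) (sym (I-diag i))
... | no i≢j = trans (I-offdiag (λ eq → i≢j (FinP.↑ˡ-injective n i j eq))) (sym (I-offdiag i≢j))

Σℚ-select : ∀ {k} (s : Fin k) (f : Fin k → ℚ) → Σℚ (λ i → ℤtoℚ (I s i) ℚ.* f i) ≡ f s
Σℚ-select zero f = begin
  1ℚ ℚ.* f zero ℚ.+ Σℚ (λ i → 0ℚ ℚ.* f (suc i))  ≡⟨ cong₂ ℚ._+_ (ℚP.*-identityˡ (f zero)) (Σℚ-zero (λ i → ℚP.*-zeroˡ (f (suc i)))) ⟩
  f zero ℚ.+ 0ℚ                                  ≡⟨ ℚP.+-identityʳ _ ⟩
  f zero                                         ∎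
  where open ≡-Reasoning
Σℚ-select (suc s) f = begin
  0ℚ ℚ.* f zero ℚ.+ Σℚ (λ i → ℤtoℚ (I (suc s) (suc i)) ℚ.* f (suc i))
    ≡⟨ cong₂ ℚ._+_ (ℚP.*-zeroˡ (f zero)) (Σℚ-cong (λ i → cong (λ z → ℤtoℚ z ℚ.* f (suc i)) (I-suc s i))) ⟩
  0ℚ ℚ.+ Σℚ (λ i → ℤtoℚ (I s i) ℚ.* f (suc i))  ≡⟨ ℚP.+-identityˡ _ ⟩
  Σℚ (λ i → ℤtoℚ (I s i) ℚ.* f (suc i))         ≡⟨ Σℚ-select s (λ i → f (suc i)) ⟩
  f (suc s)                                     ∎
  where open ≡-Reasoning

Σℚ-selectʳ : ∀ {k} (s : Fin k) (f : Fin k → ℚ) → Σℚ (λ i → f i ℚ.* ℤtoℚ (I i s)) ≡ f s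
Σℚ-selectʳ s f =
  trans (Σℚ-cong (λ i → trans (ℚP.*-comm (f i) _) (cong (λ z → ℤtoℚ z ℚ.* f i) (I-sym i s)))) (Σℚ-select s f)

Σℤ-select : ∀ {k} (s : Fin k) (f : Fin k → ℤ) → Σℤ (λ i → I s i ℤ.* f i) ≡ f s
Σℤ-select zero f = begin
  1ℤ ℤ.* f zero ℤ.+ Σℤ (λ i → 0ℤ ℤ.* f (suc i))  ≡⟨ cong₂ ℤ._+_ (ℤP.*-identityˡ (f zero)) (Σℤ-zero (λ i → ℤP.*-zeroˡ (f (suc i)))) ⟩
  f zero ℤ.+ 0ℤ                                  ≡⟨ ℤP.+-identityʳ _ ⟩
  f zero                                         ∎
  where open ≡-Reasoning
Σℤ-select (suc s) f = begin
  0ℤ ℤ.* f zero ℤ.+ Σℤ (λ i → I (suc s) (suc i) ℤ.* f (suc i))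
    ≡⟨ cong (ℤ._+_ (0ℤ ℤ.* f zero)) (Σℤ-cong (λ i → cong (ℤ._* f (suc i)) (I-suc s i))) ⟩
  0ℤ ℤ.+ Σℤ (λ i → I s i ℤ.* f (suc i))          ≡⟨ ℤP.+-identityˡ _ ⟩
  Σℤ (λ i → I s i ℤ.* f (suc i))                 ≡⟨ Σℤ-select s (λ i → f (suc i)) ⟩
  f (suc s)                                      ∎
  where open ≡-Reasoning

Σℤ-I-row : ∀ {m} (x : ℤ) (t : Fin m) → Σℤ (λ u → x ℤ.* I t u) ≡ x
Σℤ-I-row x t = trans (Σℤ-cong (λ u → ℤP.*-comm x (I t u))) (Σℤ-select t (λ _ → x))

Σℤ-I-col : ∀ {m} (x : ℤ) (t : Fin m) → Σℤ (λ u → x ℤ.* I u t) ≡ x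
Σℤ-I-col x t = trans (Σℤ-cong (λ u → cong (x ℤ.*_) (I-sym u t))) (Σℤ-I-row x t)

ℤtoℚ-I-nonneg : ∀ {m} (i j : Fin m) → 0ℚ ℚ.≤ ℤtoℚ (I i j)
ℤtoℚ-I-nonneg i j with i FinP.≟ j
... | yes refl = subst (λ z → 0ℚ ℚ.≤ ℤtoℚ z) (sym (I-diag i)) (ℚP.nonNegative⁻¹ 1ℚ)
... | no i≢j = subst (λ z → 0ℚ ℚ.≤ ℤtoℚ z) (sym (I-offdiag i≢j)) ℚP.≤-refl

Σℚ-I-row : ∀ {k} (s : Fin k) → Σℚ (λ i → ℤtoℚ (I s i)) ≡ 1ℚ
Σℚ-I-row s = trans (Σℚ-cong (λ i → sym (ℚP.*-identityʳ (ℤtoℚ (I s i))))) (Σℚ-select s (λ _ → 1ℚ))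

-- Convex hulls and integral affine maps

combination : ∀ {m r} → (Fin r → ℚ) → (Fin r → Point m) → Point m
combination μ Y j = Σℚ (λ t → μ t ℚ.* Y t j)

Σℚ-combination : ∀ {m r} (b : Fin m → ℚ) (μ : Fin r → ℚ) (Y : Fin r → Point m) →
  Σℚ (λ j → b j ℚ.* combination μ Y j) ≡ Σℚ (λ t → μ t ℚ.* Σℚ (λ j → b j ℚ.* Y t j))
Σℚ-combination b μ Y = begin
  Σℚ (λ j → b j ℚ.* Σℚ (λ t → μ t ℚ.* Y t j))      ≡⟨ Σℚ-cong (λ j → Σℚ-*ˡ (b j) (λ t → μ t ℚ.* Y t j)) ⟨
  Σℚ (λ j → Σℚ (λ t → b j ℚ.* (μ t ℚ.* Y t j)))    ≡⟨ Σℚ-comm (λ j t → b j ℚ.* (μ t ℚ.* Y t j)) ⟩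
  Σℚ (λ t → Σℚ (λ j → b j ℚ.* (μ t ℚ.* Y t j)))    ≡⟨ Σℚ-cong (λ t → Σℚ-cong (λ j → exchange (b j) (μ t) (Y t j))) ⟩
  Σℚ (λ t → Σℚ (λ j → μ t ℚ.* (b j ℚ.* Y t j)))    ≡⟨ Σℚ-cong (λ t → Σℚ-*ˡ (μ t) (λ j → b j ℚ.* Y t j)) ⟩
  Σℚ (λ t → μ t ℚ.* Σℚ (λ j → b j ℚ.* Y t j))      ∎
  where
  open ≡-Reasoning
  exchange : ∀ x y z → x ℚ.* (y ℚ.* z) ≡ y ℚ.* (x ℚ.* z)
  exchange x y z = trans (sym (ℚP.*-assoc x y z)) (trans (cong (ℚ._* z) (ℚP.*-comm x y)) (ℚP.*-assoc y x z))

combination-∘ : ∀ {m k r} (μ : Fin r → ℚ) (L : Fin r → Fin k → ℚ) (V : Fin k → Point m) →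
  combination μ (λ t → combination (L t) V) ≗ combination (λ i → Σℚ (λ t → μ t ℚ.* L t i)) V
combination-∘ μ L V j = begin
  Σℚ (λ t → μ t ℚ.* Σℚ (λ i → L t i ℚ.* V i j))      ≡⟨ Σℚ-cong (λ t → Σℚ-*ˡ (μ t) (λ i → L t i ℚ.* V i j)) ⟨
  Σℚ (λ t → Σℚ (λ i → μ t ℚ.* (L t i ℚ.* V i j)))    ≡⟨ Σℚ-comm (λ t i → μ t ℚ.* (L t i ℚ.* V i j)) ⟩
  Σℚ (λ i → Σℚ (λ t → μ t ℚ.* (L t i ℚ.* V i j)))    ≡⟨ Σℚ-cong (λ i → Σℚ-cong (λ t → ℚP.*-assoc (μ t) (L t i) (V i j))) ⟨
  Σℚ (λ i → Σℚ (λ t → μ t ℚ.* L t i ℚ.* V i j))      ≡⟨ Σℚ-cong (λ i → Σℚ-*ʳ (V i j) (λ t → μ t ℚ.* L t i)) ⟩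
  Σℚ (λ i → Σℚ (λ t → μ t ℚ.* L t i) ℚ.* V i j)      ∎
  where open ≡-Reasoning

conv-resp-≗ : ∀ {m k} {V : Fin k → Point m} {x y : Point m} → x ≗ y → conv V x → conv V y
conv-resp-≗ x≗y (λs , λs≥0 , Σλs≡1 , x≗λsV) = λs , λs≥0 , Σλs≡1 , λ j → trans (sym (x≗y j)) (x≗λsV j)

vertex∈conv : ∀ {m k} (V : Fin k → Point m) (s : Fin k) → conv V (V s)
vertex∈conv V s = (λ i → ℤtoℚ (I s i)) , ℤtoℚ-I-nonneg s , Σℚ-I-row s , λ j → sym (Σℚ-select s (λ i → V i j))

combination∈conv : ∀ {m k r} {V : Fin k → Point m} {Y : Fin r → Point m} (μ : Fin r → ℚ) →
  (∀ t → 0ℚ ℚ.≤ μ t) → Σℚ μ ≡ 1ℚ → (∀ t → conv V (Y t)) → conv V (combination μ Y)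
combination∈conv {V = V} {Y} μ μ≥0 Σμ≡1 Y∈conv = λs , λs≥0 , Σλs≡1 , Y≗λsV
  where
  L = λ t → proj₁ (Y∈conv t)
  λs = λ i → Σℚ (λ t → μ t ℚ.* L t i)
  λs≥0 : ∀ i → 0ℚ ℚ.≤ λs i
  λs≥0 i = Σℚ-nonneg (λ t → *-nonneg (μ≥0 t) (proj₁ (proj₂ (Y∈conv t)) i))
  Σλs≡1 : Σℚ λs ≡ 1ℚ
  Σλs≡1 = begin
    Σℚ (λ i → Σℚ (λ t → μ t ℚ.* L t i))  ≡⟨ Σℚ-comm (λ i t → μ t ℚ.* L t i) ⟩
    Σℚ (λ t → Σℚ (λ i → μ t ℚ.* L t i))  ≡⟨ Σℚ-cong (λ t → Σℚ-*ˡ (μ t) (L t)) ⟩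
    Σℚ (λ t → μ t ℚ.* Σℚ (L t))          ≡⟨ Σℚ-cong (λ t → cong (μ t ℚ.*_) (proj₁ (proj₂ (proj₂ (Y∈conv t))))) ⟩
    Σℚ (λ t → μ t ℚ.* 1ℚ)                ≡⟨ Σℚ-cong (λ t → ℚP.*-identityʳ (μ t)) ⟩
    Σℚ μ                                  ≡⟨ Σμ≡1 ⟩
    1ℚ                                    ∎
    where open ≡-Reasoning
  Y≗λsV : combination μ Y ≗ combination λs V
  Y≗λsV j = trans (Σℚ-cong (λ t → cong (μ t ℚ.*_) (proj₂ (proj₂ (proj₂ (Y∈conv t))) j))) (combination-∘ μ L V j)

_*ᵥ_ : ∀ {m} → Mat m → (Fin m → ℤ) → Fin m → ℤ
(M *ᵥ z) i = Σℤ (λ l → M i l ℤ.* z l)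

*ᵥ-assoc : ∀ {m} (A B : Mat m) (z : Fin m → ℤ) → A *ᵥ (B *ᵥ z) ≗ (A ⊗ B) *ᵥ z
*ᵥ-assoc A B z i = begin
  Σℤ (λ l → A i l ℤ.* Σℤ (λ t → B l t ℤ.* z t))    ≡⟨ Σℤ-cong (λ l → Σℤ-*ˡ (A i l) (λ t → B l t ℤ.* z t)) ⟨
  Σℤ (λ l → Σℤ (λ t → A i l ℤ.* (B l t ℤ.* z t)))  ≡⟨ Σℤ-comm (λ l t → A i l ℤ.* (B l t ℤ.* z t)) ⟩
  Σℤ (λ t → Σℤ (λ l → A i l ℤ.* (B l t ℤ.* z t)))  ≡⟨ Σℤ-cong (λ t → Σℤ-cong (λ l → ℤP.*-assoc (A i l) (B l t) (z t))) ⟨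
  Σℤ (λ t → Σℤ (λ l → A i l ℤ.* B l t ℤ.* z t))    ≡⟨ Σℤ-cong (λ t → Σℤ-*ʳ (z t) (λ l → A i l ℤ.* B l t)) ⟩
  Σℤ (λ t → (A ⊗ B) i t ℤ.* z t)                   ∎
  where open ≡-Reasoning

*ᵥ-neg : ∀ {m} (M : Mat m) (z : Fin m → ℤ) → M *ᵥ (λ l → ℤ.- z l) ≗ λ i → ℤ.- (M *ᵥ z) i
*ᵥ-neg M z i = trans (Σℤ-cong (λ l → sym (ℤP.neg-distribʳ-* (M i l) (z l)))) (Σℤ-neg (λ l → M i l ℤ.* z l))

I-*ᵥ : ∀ {m} (z : Fin m → ℤ) → I *ᵥ z ≗ z
I-*ᵥ z i = Σℤ-select i z

⊗-assoc : ∀ {m} (A B C : Mat m) i j → ((A ⊗ B) ⊗ C) i j ≡ (A ⊗ (B ⊗ C)) i j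
⊗-assoc A B C i j = sym (*ᵥ-assoc A B (λ l → C l j) i)

⊗-inverse : ∀ {m} {A A′ B B′ : Mat m} → (∀ i j → (A ⊗ A′) i j ≡ I i j) → (∀ i j → (B ⊗ B′) i j ≡ I i j) →
  ∀ i j → ((A ⊗ B) ⊗ (B′ ⊗ A′)) i j ≡ I i j
⊗-inverse {A = A} {A′} {B} {B′} AA′ BB′ i j = begin
  ((A ⊗ B) ⊗ (B′ ⊗ A′)) i j   ≡⟨ ⊗-assoc A B (B′ ⊗ A′) i j ⟩
  (A ⊗ (B ⊗ (B′ ⊗ A′))) i j   ≡⟨ Σℤ-cong (λ l → cong (A i l ℤ.*_) (BB′A′≡A′ l)) ⟩
  (A ⊗ A′) i j                ≡⟨ AA′ i j ⟩
  I i j                       ∎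
  where
  open ≡-Reasoning
  BB′A′≡A′ : ∀ l → (B ⊗ (B′ ⊗ A′)) l j ≡ A′ l j
  BB′A′≡A′ l = begin
    (B ⊗ (B′ ⊗ A′)) l j  ≡⟨ ⊗-assoc B B′ A′ l j ⟨
    ((B ⊗ B′) ⊗ A′) l j  ≡⟨ Σℤ-cong (λ t → cong (ℤ._* A′ t j) (BB′ l t)) ⟩
    (I ⊗ A′) l j         ≡⟨ I-*ᵥ (λ t → A′ t j) l ⟩
    A′ l j               ∎

InGL-⊗ : ∀ {m} {A B : Mat m} → InGL A → InGL B → InGL (A ⊗ B)
InGL-⊗ {A = A} {B} (A′ , AA′ , A′A) (B′ , BB′ , B′B) =
  B′ ⊗ A′ , ⊗-inverse {A = A} {A′} {B} {B′} AA′ BB′ , ⊗-inverse {A = B′} {B} {A′} {A} B′B A′A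

affine-cong : ∀ {m} {B B′ : Mat m} {c c′ : Fin m → ℤ} → (∀ i j → B i j ≡ B′ i j) → c ≗ c′ →
  ∀ v → affine B c v ≗ affine B′ c′ v
affine-cong B≡B′ c≗c′ v i =
  cong₂ ℚ._+_ (Σℚ-cong (λ j → cong (λ z → ℤtoℚ z ℚ.* v j) (B≡B′ i j))) (cong ℤtoℚ (c≗c′ i))

affine-resp-≗ : ∀ {m} (B : Mat m) (c : Fin m → ℤ) {v w : Point m} → v ≗ w → affine B c v ≗ affine B c w
affine-resp-≗ B c v≗w i = cong (ℚ._+ ℤtoℚ (c i)) (Σℚ-cong (λ j → cong (ℤtoℚ (B i j) ℚ.*_) (v≗w j)))

affine-combination : ∀ {m r} (B : Mat m) (c : Fin m → ℤ) (μ : Fin r → ℚ) (Y : Fin r → Point m) → Σℚ μ ≡ 1ℚ →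
  affine B c (combination μ Y) ≗ combination μ (λ t → affine B c (Y t))
affine-combination B c μ Y Σμ≡1 i = begin
  Σℚ (λ j → b j ℚ.* combination μ Y j) ℚ.+ γ                           ≡⟨ cong₂ ℚ._+_ (Σℚ-combination b μ Y) γ≡Σμγ ⟩
  Σℚ (λ t → μ t ℚ.* Σℚ (λ j → b j ℚ.* Y t j)) ℚ.+ Σℚ (λ t → μ t ℚ.* γ)
    ≡⟨ Σℚ-distrib-+ (λ t → μ t ℚ.* Σℚ (λ j → b j ℚ.* Y t j)) (λ t → μ t ℚ.* γ) ⟨
  Σℚ (λ t → μ t ℚ.* Σℚ (λ j → b j ℚ.* Y t j) ℚ.+ μ t ℚ.* γ)             ≡⟨ Σℚ-cong (λ t → ℚP.*-distribˡ-+ (μ t) _ γ) ⟨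
  Σℚ (λ t → μ t ℚ.* affine B c (Y t) i)                                ∎
  where
  open ≡-Reasoning
  b = λ j → ℤtoℚ (B i j)
  γ = ℤtoℚ (c i)
  γ≡Σμγ : γ ≡ Σℚ (λ t → μ t ℚ.* γ)
  γ≡Σμγ = begin
    γ              ≡⟨ ℚP.*-identityˡ γ ⟨
    1ℚ ℚ.* γ       ≡⟨ cong (ℚ._* γ) Σμ≡1 ⟨
    Σℚ μ ℚ.* γ     ≡⟨ Σℚ-*ʳ γ μ ⟨
    Σℚ (λ t → μ t ℚ.* γ) ∎

affine-integral : ∀ {m} (B : Mat m) (c : Fin m → ℤ) (z : Fin m → ℤ) {v : Point m} →
  (∀ j → v j ≡ ℤtoℚ (z j)) → affine B c v ≗ (λ i → ℤtoℚ ((B *ᵥ z) i ℤ.+ c i))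
affine-integral B c z {v} v≡z i = begin
  Σℚ (λ j → ℤtoℚ (B i j) ℚ.* v j) ℚ.+ ℤtoℚ (c i)
    ≡⟨ cong (ℚ._+ ℤtoℚ (c i)) (Σℚ-cong λ j → trans (cong (ℤtoℚ (B i j) ℚ.*_) (v≡z j)) (sym (ℤtoℚ-homo-* (B i j) (z j)))) ⟩
  Σℚ (λ j → ℤtoℚ (B i j ℤ.* z j)) ℚ.+ ℤtoℚ (c i)
    ≡⟨ cong (ℚ._+ ℤtoℚ (c i)) (ℤtoℚ-homo-Σ (λ j → B i j ℤ.* z j)) ⟨
  ℤtoℚ ((B *ᵥ z) i) ℚ.+ ℤtoℚ (c i)
    ≡⟨ ℤtoℚ-homo-+ ((B *ᵥ z) i) (c i) ⟨
  ℤtoℚ ((B *ᵥ z) i ℤ.+ c i)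
    ∎
  where open ≡-Reasoning

linear-∘ : ∀ {m} (C B : Mat m) (v : Point m) i →
  Σℚ (λ l → ℤtoℚ (C i l) ℚ.* Σℚ (λ j → ℤtoℚ (B l j) ℚ.* v j)) ≡ Σℚ (λ j → ℤtoℚ ((C ⊗ B) i j) ℚ.* v j)
linear-∘ C B v i = begin
  Σℚ (λ l → c l ℚ.* Σℚ (λ j → b l j ℚ.* v j))      ≡⟨ Σℚ-cong (λ l → Σℚ-*ˡ (c l) (λ j → b l j ℚ.* v j)) ⟨
  Σℚ (λ l → Σℚ (λ j → c l ℚ.* (b l j ℚ.* v j)))    ≡⟨ Σℚ-comm (λ l j → c l ℚ.* (b l j ℚ.* v j)) ⟩
  Σℚ (λ j → Σℚ (λ l → c l ℚ.* (b l j ℚ.* v j)))    ≡⟨ Σℚ-cong (λ j → Σℚ-cong (λ l → ℚP.*-assoc (c l) (b l j) (v j))) ⟨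
  Σℚ (λ j → Σℚ (λ l → c l ℚ.* b l j ℚ.* v j))      ≡⟨ Σℚ-cong (λ j → Σℚ-*ʳ (v j) (λ l → c l ℚ.* b l j)) ⟩
  Σℚ (λ j → Σℚ (λ l → c l ℚ.* b l j) ℚ.* v j)      ≡⟨ Σℚ-cong (λ j → cong (ℚ._* v j) (cast-entry j)) ⟨
  Σℚ (λ j → ℤtoℚ ((C ⊗ B) i j) ℚ.* v j)            ∎
  where
  open ≡-Reasoning
  c = λ l → ℤtoℚ (C i l)
  b = λ l j → ℤtoℚ (B l j)
  cast-entry : ∀ j → ℤtoℚ ((C ⊗ B) i j) ≡ Σℚ (λ l → c l ℚ.* b l j)
  cast-entry j = trans (ℤtoℚ-homo-Σ (λ l → C i l ℤ.* B l j)) (Σℚ-cong (λ l → ℤtoℚ-homo-* (C i l) (B l j)))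

affine-∘ : ∀ {m} (C B : Mat m) (c₂ c₁ : Fin m → ℤ) (v : Point m) →
  affine C c₂ (affine B c₁ v) ≗ affine (C ⊗ B) (λ i → (C *ᵥ c₁) i ℤ.+ c₂ i) v
affine-∘ C B c₂ c₁ v i = begin
  Σℚ (λ l → ℤtoℚ (C i l) ℚ.* (Bv l ℚ.+ ℤtoℚ (c₁ l))) ℚ.+ ℤtoℚ (c₂ i)
    ≡⟨ cong (ℚ._+ ℤtoℚ (c₂ i)) (Σℚ-cong (λ l → ℚP.*-distribˡ-+ (ℤtoℚ (C i l)) (Bv l) (ℤtoℚ (c₁ l)))) ⟩
  Σℚ (λ l → ℤtoℚ (C i l) ℚ.* Bv l ℚ.+ ℤtoℚ (C i l) ℚ.* ℤtoℚ (c₁ l)) ℚ.+ ℤtoℚ (c₂ i)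
    ≡⟨ cong (ℚ._+ ℤtoℚ (c₂ i)) (Σℚ-distrib-+ (λ l → ℤtoℚ (C i l) ℚ.* Bv l) (λ l → ℤtoℚ (C i l) ℚ.* ℤtoℚ (c₁ l))) ⟩
  (Σℚ (λ l → ℤtoℚ (C i l) ℚ.* Bv l) ℚ.+ Σℚ (λ l → ℤtoℚ (C i l) ℚ.* ℤtoℚ (c₁ l))) ℚ.+ ℤtoℚ (c₂ i)
    ≡⟨ cong₂ (λ x y → (x ℚ.+ y) ℚ.+ ℤtoℚ (c₂ i)) (linear-∘ C B v i) (sym Cc₁-cast) ⟩
  (Σℚ (λ j → ℤtoℚ ((C ⊗ B) i j) ℚ.* v j) ℚ.+ ℤtoℚ ((C *ᵥ c₁) i)) ℚ.+ ℤtoℚ (c₂ i)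
    ≡⟨ ℚP.+-assoc (Σℚ (λ j → ℤtoℚ ((C ⊗ B) i j) ℚ.* v j)) (ℤtoℚ ((C *ᵥ c₁) i)) (ℤtoℚ (c₂ i)) ⟩
  Σℚ (λ j → ℤtoℚ ((C ⊗ B) i j) ℚ.* v j) ℚ.+ (ℤtoℚ ((C *ᵥ c₁) i) ℚ.+ ℤtoℚ (c₂ i))
    ≡⟨ cong (Σℚ (λ j → ℤtoℚ ((C ⊗ B) i j) ℚ.* v j) ℚ.+_) (ℤtoℚ-homo-+ ((C *ᵥ c₁) i) (c₂ i)) ⟨
  affine (C ⊗ B) (λ i → (C *ᵥ c₁) i ℤ.+ c₂ i) v i
    ∎
  where
  open ≡-Reasoning
  Bv = λ l → Σℚ (λ j → ℤtoℚ (B l j) ℚ.* v j)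
  Cc₁-cast : ℤtoℚ ((C *ᵥ c₁) i) ≡ Σℚ (λ l → ℤtoℚ (C i l) ℚ.* ℤtoℚ (c₁ l))
  Cc₁-cast = trans (ℤtoℚ-homo-Σ (λ l → C i l ℤ.* c₁ l)) (Σℚ-cong (λ l → ℤtoℚ-homo-* (C i l) (c₁ l)))

affine-identity : ∀ {m} (v : Point m) → affine I (λ _ → 0ℤ) v ≗ v
affine-identity v i = trans (ℚP.+-identityʳ _) (Σℚ-select i v)

inverseShift : ∀ {m} → Mat m → (Fin m → ℤ) → Fin m → ℤ
inverseShift C c i = ℤ.- (C *ᵥ c) i

affine-inverseˡ : ∀ {m} {B C : Mat m} (c : Fin m → ℤ) → (∀ i j → (C ⊗ B) i j ≡ I i j) →
  ∀ v → affine C (inverseShift C c) (affine B c v) ≗ v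
affine-inverseˡ {B = B} {C} c CB v i = begin
  affine C (inverseShift C c) (affine B c v) i                         ≡⟨ affine-∘ C B (inverseShift C c) c v i ⟩
  affine (C ⊗ B) (λ i → (C *ᵥ c) i ℤ.+ inverseShift C c i) v i        ≡⟨ affine-cong CB (λ i → ℤP.+-inverseʳ ((C *ᵥ c) i)) v i ⟩
  affine I (λ _ → 0ℤ) v i                                              ≡⟨ affine-identity v i ⟩
  v i                                                                   ∎
  where open ≡-Reasoning

affine-injective : ∀ {m} {B : Mat m} (c : Fin m → ℤ) → InGL B → ∀ {v w} → affine B c v ≗ affine B c w → v ≗ w
affine-injective {B = B} c (C , _ , CB) {v} {w} fv≗fw i =
  trans (sym (left-inverse v i)) (trans (affine-resp-≗ C (inverseShift C c) fv≗fw i) (left-inverse w i))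
  where left-inverse = affine-inverseˡ {B = B} {C} c CB

-- Unimodular equivalence

unimodEquiv-intro : ∀ {m k k′} {V : Fin k → Point m} {W : Fin k′ → Point m} (B : Mat m) (c : Fin m → ℤ) → InGL B →
  (∀ s → conv W (affine B c (V s))) →
  (∀ t → Σ (Point m) λ v → conv V v × affine B c v ≗ W t) →
  UnimodEquiv (conv V) (conv W)
unimodEquiv-intro {m} {V = V} {W} B c B∈GL V↦W W↤V = B , c , B∈GL , λ y → mk⇔ (preimage y) (image y)
  where
  image : ∀ y → (Σ (Point m) λ v → conv V v × affine B c v ≗ y) → conv W y
  image y (v , (μ , μ≥0 , Σμ≡1 , v≗μV) , fv≗y) = conv-resp-≗ μfV≗y (combination∈conv μ μ≥0 Σμ≡1 V↦W)
    where
    μfV≗y : combination μ (λ s → affine B c (V s)) ≗ y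
    μfV≗y i = trans (sym (affine-combination B c μ V Σμ≡1 i)) (trans (sym (affine-resp-≗ B c v≗μV i)) (fv≗y i))
  preimage : ∀ y → conv W y → Σ (Point m) λ v → conv V v × affine B c v ≗ y
  preimage y (μ , μ≥0 , Σμ≡1 , y≗μW) = combination μ v , combination∈conv μ μ≥0 Σμ≡1 v∈V , fμv≗y
    where
    v = λ t → proj₁ (W↤V t)
    v∈V = λ t → proj₁ (proj₂ (W↤V t))
    fμv≗y : affine B c (combination μ v) ≗ y
    fμv≗y i = trans (affine-combination B c μ v Σμ≡1 i)
                (trans (Σℚ-cong (λ t → cong (μ t ℚ.*_) (proj₂ (proj₂ (W↤V t)) i))) (sym (y≗μW i)))

unimodEquiv-of-vertices : ∀ {m k k′} {V : Fin k → Point m} {W : Fin k′ → Point m} (B : Mat m) (c : Fin m → ℤ) →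
  InGL B → (π : Fin k → Fin k′) → (∀ s → affine B c (V s) ≗ W (π s)) → (∀ t → ∃ λ s → π s ≡ t) →
  UnimodEquiv (conv V) (conv W)
unimodEquiv-of-vertices {V = V} {W} B c B∈GL π fV≗Wπ π-surjective = unimodEquiv-intro B c B∈GL
  (λ s → conv-resp-≗ (λ i → sym (fV≗Wπ s i)) (vertex∈conv W (π s)))
  (λ t → let (s , πs≡t) = π-surjective t in
         V s , vertex∈conv V s , λ i → trans (fV≗Wπ s i) (cong (λ u → W u i) πs≡t))

unimodEquiv-sym : ∀ {m k k′} {V : Fin k → Point m} {W : Fin k′ → Point m} →
  UnimodEquiv (conv V) (conv W) → UnimodEquiv (conv W) (conv V)
unimodEquiv-sym {m} {V = V} {W} (B , c , (C , BC , CB) , E) = unimodEquiv-intro C (inverseShift C c) (B , CB , BC) W↦V V↤W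
  where
  g = affine C (inverseShift C c)
  g∘f≗id = affine-inverseˡ {B = B} {C} c CB
  W↦V : ∀ t → conv V (g (W t))
  W↦V t with Equivalence.to (E (W t)) (vertex∈conv W t)
  ... | v , v∈V , fv≗Wt = conv-resp-≗ (λ i → trans (sym (g∘f≗id v i)) (affine-resp-≗ C (inverseShift C c) fv≗Wt i)) v∈V
  V↤W : ∀ s → Σ (Point m) λ w → conv W w × g w ≗ V s
  V↤W s = affine B c (V s) , Equivalence.from (E _) (V s , vertex∈conv V s , λ _ → refl) , g∘f≗id (V s)

unimodEquiv-trans : ∀ {m k k′ k″} {U : Fin k → Point m} {V : Fin k′ → Point m} {W : Fin k″ → Point m} →
  UnimodEquiv (conv U) (conv V) → UnimodEquiv (conv V) (conv W) → UnimodEquiv (conv U) (conv W)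
unimodEquiv-trans {m} {U = U} {V} {W} (B₁ , c₁ , B₁∈GL , E₁) (B₂ , c₂ , B₂∈GL , E₂) =
  unimodEquiv-intro (B₂ ⊗ B₁) c (InGL-⊗ {A = B₂} {B₁} B₂∈GL B₁∈GL) U↦W W↤U
  where
  c = λ i → (B₂ *ᵥ c₁) i ℤ.+ c₂ i
  f₂∘f₁ = affine-∘ B₂ B₁ c₂ c₁
  U↦W : ∀ s → conv W (affine (B₂ ⊗ B₁) c (U s))
  U↦W s = conv-resp-≗ (f₂∘f₁ (U s)) (Equivalence.from (E₂ _)
    (affine B₁ c₁ (U s) , Equivalence.from (E₁ _) (U s , vertex∈conv U s , λ _ → refl) , λ _ → refl))
  W↤U : ∀ t → Σ (Point m) λ u → conv U u × affine (B₂ ⊗ B₁) c u ≗ W t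
  W↤U t with Equivalence.to (E₂ (W t)) (vertex∈conv W t)
  ... | v , v∈V , f₂v≗Wt with Equivalence.to (E₁ v) v∈V
  ... | u , u∈U , f₁u≗v = u , u∈U , λ i → trans (sym (f₂∘f₁ u i)) (trans (affine-resp-≗ B₂ c₂ f₁u≗v i) (f₂v≗Wt i))

injective⇒surjective : ∀ {n} (π : Fin n → Fin n) → (∀ {s s′} → π s ≡ π s′ → s ≡ s′) → ∀ t → ∃ λ s → π s ≡ t
injective⇒surjective {suc n} π π-injective t with FinP.any? (λ s → π s FinP.≟ t)
... | yes hit = hit
... | no miss = ⊥-elim (no-collision (FinP.pigeonhole (ℕP.n<1+n n) (λ s → Fin.punchOut (missed s))))
  where
  missed : ∀ s → t ≢ π s
  missed s t≡πs = miss (s , sym t≡πs)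
  no-collision : ¬ ∃₂ λ s s′ → s Fin.< s′ × Fin.punchOut (missed s) ≡ Fin.punchOut (missed s′)
  no-collision (s , s′ , s<s′ , same-slot) =
    FinP.<⇒≢ s<s′ (π-injective (FinP.punchOut-injective (missed s) (missed s′) same-slot))

Extreme : ∀ {m k} → (Fin k → Point m) → Fin k → Set
Extreme V s = ∀ λs → (∀ i → 0ℚ ℚ.≤ λs i) → Σℚ λs ≡ 1ℚ → V s ≗ combination λs V → λs s ≡ 1ℚ

combination-concentrated : ∀ {m k} (V : Fin k → Point m) {L : Fin k → ℚ} → (∀ i → 0ℚ ℚ.≤ L i) → Σℚ L ≡ 1ℚ →
  ∀ s → L s ≡ 1ℚ → combination L V ≗ V s
combination-concentrated V {L} L≥0 ΣL≡1 s Ls≡1 j = begin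
  Σℚ (λ i → L i ℚ.* V i j)                ≡⟨ Σℚ-cong (λ i → cong (ℚ._* V i j) (sym (δₛ≗L i))) ⟩
  Σℚ (λ i → ℤtoℚ (I s i) ℚ.* V i j)       ≡⟨ Σℚ-select s (λ i → V i j) ⟩
  V s j                                   ∎
  where
  open ≡-Reasoning
  δₛ≤L : ∀ i → ℤtoℚ (I s i) ℚ.≤ L i
  δₛ≤L i with s FinP.≟ i
  ... | yes refl = subst₂ ℚ._≤_ (sym (cong ℤtoℚ (I-diag s))) (sym Ls≡1) ℚP.≤-refl
  ... | no s≢i = subst (ℚ._≤ L i) (sym (cong ℤtoℚ (I-offdiag s≢i))) (L≥0 i)
  δₛ≗L : ∀ i → ℤtoℚ (I s i) ≡ L i
  δₛ≗L = Σℚ-≤-equal δₛ≤L (trans (Σℚ-I-row s) (sym ΣL≡1))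

extreme↦vertex : ∀ {m k k′} {V : Fin k → Point m} {W : Fin k′ → Point m} (B : Mat m) (c : Fin m → ℤ) → InGL B →
  (∀ y → conv W y ⇔ (Σ (Point m) λ v → conv V v × affine B c v ≗ y)) →
  ∀ s → Extreme V s → ∃ λ t → affine B c (V s) ≗ W t
extreme↦vertex {V = V} {W} B c B∈GL E s V-extreme
  with Equivalence.from (E (affine B c (V s))) (V s , vertex∈conv V s , λ _ → refl)
... | μ , μ≥0 , Σμ≡1 , fVs≗μW = t , λ i → trans (affine-resp-≗ B c (λ j → sym (vₜ≗Vs j)) i) (fv≗W t i)
  where
  f = affine B c
  preimage = λ t → Equivalence.to (E (W t)) (vertex∈conv W t)
  v = λ t → proj₁ (preimage t)
  v∈V = λ t → proj₁ (proj₂ (preimage t))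
  fv≗W = λ t → proj₂ (proj₂ (preimage t))
  L = λ t → proj₁ (v∈V t)
  L≥0 = λ t → proj₁ (proj₂ (v∈V t))
  ΣL≡1 = λ t → proj₁ (proj₂ (proj₂ (v∈V t)))
  u = combination μ v
  u∈V = combination∈conv μ μ≥0 Σμ≡1 v∈V
  fu≗fVs : f u ≗ f (V s)
  fu≗fVs i = trans (affine-combination B c μ v Σμ≡1 i)
    (trans (Σℚ-cong (λ t → cong (μ t ℚ.*_) (fv≗W t i))) (sym (fVs≗μW i)))
  weight-at-s : Σℚ (λ t → μ t ℚ.* L t s) ≡ 1ℚ
  weight-at-s = V-extreme (proj₁ u∈V) (proj₁ (proj₂ u∈V)) (proj₁ (proj₂ (proj₂ u∈V)))
    (λ j → trans (sym (affine-injective c B∈GL fu≗fVs j)) (proj₂ (proj₂ (proj₂ u∈V)) j))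
  μL≤μ : ∀ t → μ t ℚ.* L t s ℚ.≤ μ t
  μL≤μ t = subst (μ t ℚ.* L t s ℚ.≤_) (ℚP.*-identityʳ (μ t))
    (ℚP.*-monoˡ-≤-nonNeg (μ t) {{ℚ.nonNegative (μ≥0 t)}} (subst (L t s ℚ.≤_) (ΣL≡1 t) (Σℚ-single-≤ (L≥0 t) s)))
  μL≡μ : ∀ t → μ t ℚ.* L t s ≡ μ t
  μL≡μ = Σℚ-≤-equal μL≤μ (trans weight-at-s (sym Σμ≡1))
  nonzero-weight = Σℚ-nonzero μ (λ Σμ≡0 → ℚP.1≢0 (trans (sym Σμ≡1) Σμ≡0))
  t = proj₁ nonzero-weight
  Lₜs≡1 : L t s ≡ 1ℚ
  Lₜs≡1 = *-cancelˡ-≡ (proj₂ nonzero-weight)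
    (trans (μL≡μ t) (sym (ℚP.*-identityʳ (μ t))))
  vₜ≗Vs : v t ≗ V s
  vₜ≗Vs j = trans (proj₂ (proj₂ (proj₂ (v∈V t))) j) (combination-concentrated V (L≥0 t) (ΣL≡1 t) s Lₜs≡1 j)

-- Integer 2 × 2 matrices

mat₂ : ℤ → ℤ → ℤ → ℤ → Mat 2
mat₂ p q r s zero       zero       = p
mat₂ p q r s zero       (suc zero) = q
mat₂ p q r s (suc zero) zero       = r
mat₂ p q r s (suc zero) (suc zero) = s

det₂ : ℤ → ℤ → ℤ → ℤ → ℤ
det₂ p q r s = p ℤ.* s ℤ.- q ℤ.* r

det-cancel : ∀ {a b c d x} → Nondeg a b c d → det₂ a b c d ℤ.* x ≡ 0ℤ → x ≡ 0ℤ
det-cancel {a} {b} {c} {d} nd det*x≡0 with ℤP.i*j≡0⇒i≡0∨j≡0 (det₂ a b c d) det*x≡0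
... | inj₁ det≡0 = ⊥-elim (nd det≡0)
... | inj₂ x≡0 = x≡0

ℤtoℚ-det₂ : ∀ a b c d → ℤtoℚ (det₂ a b c d) ≡ ℤtoℚ a ℚ.* ℤtoℚ d ℚ.- ℤtoℚ b ℚ.* ℤtoℚ c
ℤtoℚ-det₂ a b c d = trans (ℤtoℚ-homo-+ (a ℤ.* d) (ℤ.- (b ℤ.* c)))
  (cong₂ ℚ._+_ (ℤtoℚ-homo-* a d) (trans (ℤtoℚ-homo‿- (b ℤ.* c)) (cong ℚ.-_ (ℤtoℚ-homo-* b c))))

-- The inverse is det · adj, which is integral because det² = 1.
InGL₂ : ∀ p q r s → det₂ p q r s ℤ.* det₂ p q r s ≡ 1ℤ → InGL (mat₂ p q r s)
InGL₂ p q r s δ²≡1 = N , right-inverse , left-inverse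
  where
  open +-*-Solver using (_:+_; _:*_; :-_; _:-_; _:=_; con) renaming (solve to polynomial)
  δ = det₂ p q r s
  N = mat₂ (δ ℤ.* s) (δ ℤ.* ℤ.- q) (δ ℤ.* ℤ.- r) (δ ℤ.* p)
  right-inverse : ∀ i j → (mat₂ p q r s ⊗ N) i j ≡ I i j
  right-inverse zero       zero       = trans (polynomial 5 (λ p q r s δ → p :* (δ :* s) :+ (q :* (δ :* :- r) :+ con 0ℤ) := δ :* (p :* s :- q :* r)) refl p q r s δ) δ²≡1
  right-inverse zero       (suc zero) = polynomial 5 (λ p q r s δ → p :* (δ :* :- q) :+ (q :* (δ :* p) :+ con 0ℤ) := con 0ℤ) refl p q r s δ
  right-inverse (suc zero) zero       = polynomial 5 (λ p q r s δ → r :* (δ :* s) :+ (s :* (δ :* :- r) :+ con 0ℤ) := con 0ℤ) refl p q r s δ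
  right-inverse (suc zero) (suc zero) = trans (polynomial 5 (λ p q r s δ → r :* (δ :* :- q) :+ (s :* (δ :* p) :+ con 0ℤ) := δ :* (p :* s :- q :* r)) refl p q r s δ) δ²≡1
  left-inverse : ∀ i j → (N ⊗ mat₂ p q r s) i j ≡ I i j
  left-inverse zero       zero       = trans (polynomial 5 (λ p q r s δ → δ :* s :* p :+ (δ :* :- q :* r :+ con 0ℤ) := δ :* (p :* s :- q :* r)) refl p q r s δ) δ²≡1
  left-inverse zero       (suc zero) = polynomial 5 (λ p q r s δ → δ :* s :* q :+ (δ :* :- q :* s :+ con 0ℤ) := con 0ℤ) refl p q r s δ
  left-inverse (suc zero) zero       = polynomial 5 (λ p q r s δ → δ :* :- r :* p :+ (δ :* p :* r :+ con 0ℤ) := con 0ℤ) refl p q r s δ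
  left-inverse (suc zero) (suc zero) = trans (polynomial 5 (λ p q r s δ → δ :* :- r :* q :+ (δ :* p :* s :+ con 0ℤ) := δ :* (p :* s :- q :* r)) refl p q r s δ) δ²≡1

det₂-⊗ : ∀ p q r s p′ q′ r′ s′ → det₂ p q r s ℤ.* det₂ p′ q′ r′ s′ ≡
  det₂ (p ℤ.* p′ ℤ.+ q ℤ.* r′) (p ℤ.* q′ ℤ.+ q ℤ.* s′) (r ℤ.* p′ ℤ.+ s ℤ.* r′) (r ℤ.* q′ ℤ.+ s ℤ.* s′)
det₂-⊗ = product-of-determinants
  where
  product-of-determinants : ∀ p q r s p′ q′ r′ s′ → (p ℤ.* s ℤ.- q ℤ.* r) ℤ.* (p′ ℤ.* s′ ℤ.- q′ ℤ.* r′) ≡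
    (p ℤ.* p′ ℤ.+ q ℤ.* r′) ℤ.* (r ℤ.* q′ ℤ.+ s ℤ.* s′) ℤ.- (p ℤ.* q′ ℤ.+ q ℤ.* s′) ℤ.* (r ℤ.* p′ ℤ.+ s ℤ.* r′)
  product-of-determinants = solve-∀

unit-square : ∀ x y → x ℤ.* y ≡ 1ℤ → y ℤ.* y ≡ 1ℤ
unit-square x y xy≡1 = square-of-unit y (ℕP.m*n≡1⇒n≡1 ℤ.∣ x ∣ ℤ.∣ y ∣ (trans (sym (ℤP.abs-* x y)) (cong ℤ.∣_∣ xy≡1)))
  where
  square-of-unit : ∀ y → ℤ.∣ y ∣ ≡ 1 → y ℤ.* y ≡ 1ℤ
  square-of-unit (ℤ.+ 1)      refl = refl
  square-of-unit ℤ.-[1+ 0 ] refl = refl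

left-inverse⇒InGL₂ : ∀ {p q r s} (C : Mat 2) → (∀ i j → (C ⊗ mat₂ p q r s) i j ≡ I i j) → InGL (mat₂ p q r s)
left-inverse⇒InGL₂ {p} {q} {r} {s} C CM≡I = InGL₂ p q r s (unit-square detC (det₂ p q r s) detC*detM≡1)
  where
  detC = det₂ (C zero zero) (C zero (suc zero)) (C (suc zero) zero) (C (suc zero) (suc zero))
  entry≡I : ∀ i j → C i zero ℤ.* mat₂ p q r s zero j ℤ.+ C i (suc zero) ℤ.* mat₂ p q r s (suc zero) j ≡ I i j
  entry≡I i j = trans (cong (ℤ._+_ (C i zero ℤ.* mat₂ p q r s zero j)) (sym (ℤP.+-identityʳ _))) (CM≡I i j)
  detC*detM≡1 : detC ℤ.* det₂ p q r s ≡ 1ℤ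
  detC*detM≡1 = trans (det₂-⊗ (C zero zero) (C zero (suc zero)) (C (suc zero) zero) (C (suc zero) (suc zero)) p q r s)
    (cong₂ ℤ._-_ (cong₂ ℤ._*_ (entry≡I zero zero) (entry≡I (suc zero) (suc zero)))
                 (cong₂ ℤ._*_ (entry≡I zero (suc zero)) (entry≡I (suc zero) zero)))

-- The vertices of Qₙ

vertexℤ : ℤ → ℤ → ℤ → ℤ → ∀ {m} → Fin (3 + m) → Fin (2 + m) → ℤ
vertexℤ a b c d zero                   _                = 0ℤ
vertexℤ a b c d (suc zero)             zero             = a
vertexℤ a b c d (suc zero)             (suc zero)       = b
vertexℤ a b c d (suc zero)             (suc (suc _))    = 0ℤ
vertexℤ a b c d (suc (suc zero))       zero             = c
vertexℤ a b c d (suc (suc zero))       (suc zero)       = d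
vertexℤ a b c d (suc (suc zero))       (suc (suc _))    = 0ℤ
vertexℤ a b c d (suc (suc (suc t)))    zero             = 0ℤ
vertexℤ a b c d (suc (suc (suc t)))    (suc zero)       = 0ℤ
vertexℤ a b c d (suc (suc (suc t)))    (suc (suc j))    = I t j

corner : ℤ → ℤ → ℤ → ℤ → Fin 3 → Fin 2 → ℤ
corner a b c d = vertexℤ a b c d {0}

vertexCoord-basis : ∀ a b c d {m} (t j : Fin m) →
  vertexCoord a b c d (3 + toℕ t) (2 + toℕ j) ≡ ℤtoℚ (I t j)
vertexCoord-basis a b c d t j with t FinP.≟ j
... | yes refl = trans (on-diagonal (toℕ t)) (cong ℤtoℚ (sym (I-diag t)))
  where
  on-diagonal : ∀ n → vertexCoord a b c d (3 + n) (2 + n) ≡ 1ℚ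
  on-diagonal n with suc (suc n) ℕ.≟ suc (suc n)
  ... | yes _ = refl
  ... | no n≢n = ⊥-elim (n≢n refl)
... | no t≢j = trans (off-diagonal (toℕ t) (toℕ j) (λ j≡t → t≢j (sym (FinP.toℕ-injective j≡t))))
                     (cong ℤtoℚ (sym (I-offdiag t≢j)))
  where
  off-diagonal : ∀ n l → l ≢ n → vertexCoord a b c d (3 + n) (2 + l) ≡ 0ℚ
  off-diagonal n l l≢n with suc (suc l) ℕ.≟ suc (suc n)
  ... | yes l≡n = ⊥-elim (l≢n (ℕP.suc-injective (ℕP.suc-injective l≡n)))
  ... | no _ = refl

Qverts-integral : ∀ {m} a b c d (s : Fin (3 + m)) (j : Fin (2 + m)) →
  Qverts (2 + m) a b c d s j ≡ ℤtoℚ (vertexℤ a b c d s j)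
Qverts-integral a b c d zero                j                = refl
Qverts-integral a b c d (suc zero)          zero             = refl
Qverts-integral a b c d (suc zero)          (suc zero)       = refl
Qverts-integral a b c d (suc zero)          (suc (suc _))    = refl
Qverts-integral a b c d (suc (suc zero))    zero             = refl
Qverts-integral a b c d (suc (suc zero))    (suc zero)       = refl
Qverts-integral a b c d (suc (suc zero))    (suc (suc _))    = refl
Qverts-integral a b c d (suc (suc (suc t))) zero             = refl
Qverts-integral a b c d (suc (suc (suc t))) (suc zero)       = refl
Qverts-integral a b c d (suc (suc (suc t))) (suc (suc j))    = vertexCoord-basis a b c d t j

corner-or-basis : ∀ {n} (j : Fin (3 + n)) → (∃ λ σ → j ≡ σ ↑ˡ n) ⊎ (∃ λ u → j ≡ 3 ↑ʳ u)
corner-or-basis {n} j with Fin.splitAt 3 {n} j in split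
... | inj₁ σ = inj₁ (σ , sym (FinP.splitAt⁻¹-↑ˡ split))
... | inj₂ u = inj₂ (u , sym (FinP.splitAt⁻¹-↑ʳ split))

vertexℤ-corner : ∀ {m} a b c d (σ : Fin 3) (i : Fin 2) → vertexℤ a b c d {m} (σ ↑ˡ m) (i ↑ˡ m) ≡ corner a b c d σ i
vertexℤ-corner a b c d zero             zero       = refl
vertexℤ-corner a b c d zero             (suc zero) = refl
vertexℤ-corner a b c d (suc zero)       zero       = refl
vertexℤ-corner a b c d (suc zero)       (suc zero) = refl
vertexℤ-corner a b c d (suc (suc zero)) zero       = refl
vertexℤ-corner a b c d (suc (suc zero)) (suc zero) = refl

vertexℤ-corner-tail : ∀ {m} a b c d (σ : Fin 3) (u : Fin m) → vertexℤ a b c d (σ ↑ˡ m) (2 ↑ʳ u) ≡ 0ℤ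
vertexℤ-corner-tail a b c d zero             u = refl
vertexℤ-corner-tail a b c d (suc zero)       u = refl
vertexℤ-corner-tail a b c d (suc (suc zero)) u = refl

vertexℤ-basis-coordinate : ∀ {m} a b c d {j : Fin (3 + m)} {u : Fin m} → j ≢ 3 ↑ʳ u → vertexℤ a b c d j (2 ↑ʳ u) ≡ 0ℤ
vertexℤ-basis-coordinate a b c d {j} {u} j≢u with corner-or-basis j
... | inj₁ (σ , refl) = vertexℤ-corner-tail a b c d σ u
... | inj₂ (u′ , refl) = I-offdiag (λ u′≡u → j≢u (cong (3 ↑ʳ_) u′≡u))

*ᵥ-corner : ∀ {k} a b c d (M : Mat (3 + k)) (σ : Fin 3) r →
  (M *ᵥ vertexℤ a b c d (σ ↑ˡ suc k)) r ≡ M r zero ℤ.* corner a b c d σ zero ℤ.+ M r (suc zero) ℤ.* corner a b c d σ (suc zero)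
*ᵥ-corner {k} a b c d M σ r = begin
  M r zero ℤ.* z zero ℤ.+ (M r (suc zero) ℤ.* z (suc zero) ℤ.+ Σℤ (λ u → M r (2 ↑ʳ u) ℤ.* z (2 ↑ʳ u)))
    ≡⟨ cong (λ w → M r zero ℤ.* z zero ℤ.+ (M r (suc zero) ℤ.* z (suc zero) ℤ.+ w))
         (Σℤ-zero (λ u → trans (cong (M r (2 ↑ʳ u) ℤ.*_) (vertexℤ-corner-tail a b c d σ u)) (ℤP.*-zeroʳ (M r (2 ↑ʳ u))))) ⟩
  M r zero ℤ.* z zero ℤ.+ (M r (suc zero) ℤ.* z (suc zero) ℤ.+ 0ℤ)
    ≡⟨ cong₂ (λ p q → M r zero ℤ.* p ℤ.+ q) (vertexℤ-corner a b c d σ zero)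
         (trans (ℤP.+-identityʳ _) (cong (M r (suc zero) ℤ.*_) (vertexℤ-corner a b c d σ (suc zero)))) ⟩
  M r zero ℤ.* corner a b c d σ zero ℤ.+ M r (suc zero) ℤ.* corner a b c d σ (suc zero)
    ∎
  where
  open ≡-Reasoning
  z = vertexℤ a b c d (σ ↑ˡ suc k)

drop-zero-terms : ∀ {m} u x y (w : Fin m → ℚ) → u ℚ.* 0ℚ ℚ.+ (x ℚ.+ (y ℚ.+ Σℚ (λ t → w t ℚ.* 0ℚ))) ≡ x ℚ.+ y
drop-zero-terms u x y w = begin
  u ℚ.* 0ℚ ℚ.+ (x ℚ.+ (y ℚ.+ Σℚ (λ t → w t ℚ.* 0ℚ)))
    ≡⟨ cong₂ (λ p q → p ℚ.+ (x ℚ.+ (y ℚ.+ q))) (ℚP.*-zeroʳ u) (Σℚ-zero (λ t → ℚP.*-zeroʳ (w t))) ⟩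
  0ℚ ℚ.+ (x ℚ.+ (y ℚ.+ 0ℚ))                          ≡⟨ ℚP.+-identityˡ _ ⟩
  x ℚ.+ (y ℚ.+ 0ℚ)                                   ≡⟨ cong (x ℚ.+_) (ℚP.+-identityʳ y) ⟩
  x ℚ.+ y                                            ∎
  where open ≡-Reasoning

combination-Qverts-plane : ∀ {m} a b c d (ν : Fin (3 + m) → ℚ) (i : Fin 2) →
  combination ν (Qverts (2 + m) a b c d) (i ↑ˡ m) ≡
  ν (suc zero) ℚ.* ℤtoℚ (corner a b c d (suc zero) i) ℚ.+ ν (suc (suc zero)) ℚ.* ℤtoℚ (corner a b c d (suc (suc zero)) i)
combination-Qverts-plane a b c d ν zero       =
  drop-zero-terms (ν zero) (ν (suc zero) ℚ.* ℤtoℚ a) (ν (suc (suc zero)) ℚ.* ℤtoℚ c) (λ t → ν (suc (suc (suc t))))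
combination-Qverts-plane a b c d ν (suc zero) =
  drop-zero-terms (ν zero) (ν (suc zero) ℚ.* ℤtoℚ b) (ν (suc (suc zero)) ℚ.* ℤtoℚ d) (λ t → ν (suc (suc (suc t))))

combination-Qverts-tail : ∀ {m} a b c d (ν : Fin (3 + m) → ℚ) (u : Fin m) →
  combination ν (Qverts (2 + m) a b c d) (2 ↑ʳ u) ≡ ν (3 ↑ʳ u)
combination-Qverts-tail a b c d ν u = begin
  ν zero ℚ.* 0ℚ ℚ.+ (ν (suc zero) ℚ.* 0ℚ ℚ.+ (ν (suc (suc zero)) ℚ.* 0ℚ ℚ.+ tail))
    ≡⟨ cong₂ ℚ._+_ (ℚP.*-zeroʳ (ν zero)) (cong₂ ℚ._+_ (ℚP.*-zeroʳ (ν (suc zero)))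
         (cong (ℚ._+ tail) (ℚP.*-zeroʳ (ν (suc (suc zero)))))) ⟩
  0ℚ ℚ.+ (0ℚ ℚ.+ (0ℚ ℚ.+ tail))                                 ≡⟨ ℚP.+-identityˡ _ ⟩
  0ℚ ℚ.+ (0ℚ ℚ.+ tail)                                          ≡⟨ ℚP.+-identityˡ _ ⟩
  0ℚ ℚ.+ tail                                                   ≡⟨ ℚP.+-identityˡ tail ⟩
  tail                                                          ≡⟨ Σℚ-cong (λ t → cong (ν (suc (suc (suc t))) ℚ.*_) (vertexCoord-basis a b c d t u)) ⟩
  Σℚ (λ t → ν (suc (suc (suc t))) ℚ.* ℤtoℚ (I t u))             ≡⟨ Σℚ-selectʳ u (λ t → ν (suc (suc (suc t)))) ⟩
  ν (suc (suc (suc u)))                                         ∎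
  where
  open ≡-Reasoning
  tail = Σℚ (λ t → ν (suc (suc (suc t))) ℚ.* Qverts _ a b c d (suc (suc (suc t))) (suc (suc u)))

-- Cramer's rule for the weights of the corners (a, b) and (c, d).
cramer-weights : ∀ {k} a b c d (ν : Fin (4 + k) → ℚ) {X Y} →
  X ≡ combination ν (Qverts (3 + k) a b c d) zero → Y ≡ combination ν (Qverts (3 + k) a b c d) (suc zero) →
  ℤtoℚ (det₂ a b c d) ℚ.* ν (suc zero) ≡ ℤtoℚ d ℚ.* X ℚ.- ℤtoℚ c ℚ.* Y ×
  ℤtoℚ (det₂ a b c d) ℚ.* ν (suc (suc zero)) ≡ ℤtoℚ a ℚ.* Y ℚ.- ℤtoℚ b ℚ.* X
cramer-weights a b c d ν {X} {Y} X≡ Y≡ =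
  trans (cong (ℚ._* ν₁) (ℤtoℚ-det₂ a b c d))
    (trans (solve 6 (λ n₁ n₂ A B C D → (A :* D :- B :* C) :* n₁ := D :* (n₁ :* A :+ n₂ :* C) :- C :* (n₁ :* B :+ n₂ :* D)) refl ν₁ ν₂ A B C D)
           (sym (cong₂ (λ x y → D ℚ.* x ℚ.- C ℚ.* y) X≡νAC Y≡νBD))) ,
  trans (cong (ℚ._* ν₂) (ℤtoℚ-det₂ a b c d))
    (trans (solve 6 (λ n₁ n₂ A B C D → (A :* D :- B :* C) :* n₂ := A :* (n₁ :* B :+ n₂ :* D) :- B :* (n₁ :* A :+ n₂ :* C)) refl ν₁ ν₂ A B C D)
           (sym (cong₂ (λ x y → A ℚ.* y ℚ.- B ℚ.* x) X≡νAC Y≡νBD)))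
  where
  open ℚSolver.+-*-Solver
  A = ℤtoℚ a
  B = ℤtoℚ b
  C = ℤtoℚ c
  D = ℤtoℚ d
  ν₁ = ν (suc zero)
  ν₂ = ν (suc (suc zero))
  X≡νAC : X ≡ ν₁ ℚ.* A ℚ.+ ν₂ ℚ.* C
  X≡νAC = trans X≡ (combination-Qverts-plane a b c d ν zero)
  Y≡νBD : Y ≡ ν₁ ℚ.* B ℚ.+ ν₂ ℚ.* D
  Y≡νBD = trans Y≡ (combination-Qverts-plane a b c d ν (suc zero))

corner-extreme : ∀ {k} a b c d → Nondeg a b c d → (s : Fin 3) → Extreme (Qverts (3 + k) a b c d) (s ↑ˡ suc k)
corner-extreme {k} a b c d nd s ν _ Σν≡1 = weight-at-corner s
  where
  open ℚSolver.+-*-Solver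
  A = ℤtoℚ a
  B = ℤtoℚ b
  C = ℤtoℚ c
  D = ℤtoℚ d
  Δ≢0 : ℤtoℚ (det₂ a b c d) ≢ 0ℚ
  Δ≢0 Δ≡0 = nd (ℤtoℚ-injective Δ≡0)
  scaled : ∀ {x} → x ≡ (A ℚ.* D ℚ.- B ℚ.* C) ℚ.* 1ℚ → x ≡ ℤtoℚ (det₂ a b c d) ℚ.* 1ℚ
  scaled x≡ = trans x≡ (cong (ℚ._* 1ℚ) (sym (ℤtoℚ-det₂ a b c d)))
  vanishing : ∀ {x} → x ≡ (A ℚ.* D ℚ.- B ℚ.* C) ℚ.* 0ℚ → x ≡ ℤtoℚ (det₂ a b c d) ℚ.* 0ℚ
  vanishing x≡ = trans x≡ (cong (ℚ._* 0ℚ) (sym (ℤtoℚ-det₂ a b c d)))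
  weight-at-corner : ∀ s → Qverts (3 + k) a b c d (s ↑ˡ suc k) ≗ combination ν (Qverts (3 + k) a b c d) → ν (s ↑ˡ suc k) ≡ 1ℚ
  weight-at-corner (suc zero) Vs≗νV = *-cancelˡ-≡ Δ≢0 (trans (proj₁ (cramer-weights a b c d ν (Vs≗νV zero) (Vs≗νV (suc zero))))
    (scaled (solve 4 (λ A B C D → D :* A :- C :* B := (A :* D :- B :* C) :* con 1ℚ) refl A B C D)))
  weight-at-corner (suc (suc zero)) Vs≗νV = *-cancelˡ-≡ Δ≢0 (trans (proj₂ (cramer-weights a b c d ν (Vs≗νV zero) (Vs≗νV (suc zero))))
    (scaled (solve 4 (λ A B C D → A :* D :- B :* C := (A :* D :- B :* C) :* con 1ℚ) refl A B C D)))
  weight-at-corner zero Vs≗νV = begin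
    ν zero                                                          ≡⟨ ℚP.+-identityʳ (ν zero) ⟨
    ν zero ℚ.+ 0ℚ                                                   ≡⟨ cong (ν zero ℚ.+_) other-weights-vanish ⟨
    ν zero ℚ.+ (ν (suc zero) ℚ.+ (ν (suc (suc zero)) ℚ.+ Σℚ (λ t → ν (suc (suc (suc t))))))  ≡⟨ Σν≡1 ⟩
    1ℚ                                                              ∎
    where
    open ≡-Reasoning
    weights = cramer-weights a b c d ν (Vs≗νV zero) (Vs≗νV (suc zero))
    ν₁≡0 : ν (suc zero) ≡ 0ℚ
    ν₁≡0 = *-cancelˡ-≡ Δ≢0 (trans (proj₁ weights)
      (vanishing (solve 4 (λ A B C D → D :* con 0ℚ :- C :* con 0ℚ := (A :* D :- B :* C) :* con 0ℚ) refl A B C D)))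
    ν₂≡0 : ν (suc (suc zero)) ≡ 0ℚ
    ν₂≡0 = *-cancelˡ-≡ Δ≢0 (trans (proj₂ weights)
      (vanishing (solve 4 (λ A B C D → A :* con 0ℚ :- B :* con 0ℚ := (A :* D :- B :* C) :* con 0ℚ) refl A B C D)))
    tail≡0 : ∀ t → ν (suc (suc (suc t))) ≡ 0ℚ
    tail≡0 t = sym (trans (Vs≗νV (suc (suc t))) (combination-Qverts-tail a b c d ν t))
    other-weights-vanish : ν (suc zero) ℚ.+ (ν (suc (suc zero)) ℚ.+ Σℚ (λ t → ν (suc (suc (suc t))))) ≡ 0ℚ
    other-weights-vanish = cong₂ ℚ._+_ ν₁≡0 (cong₂ ℚ._+_ ν₂≡0 (Σℚ-zero tail≡0))

corner-difference-spans : ∀ a b c d {σ σ′ : Fin 3} → σ ≢ σ′ → ∃₂ λ α β →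
  det₂ a b c d ≡ α ℤ.* (corner a b c d σ zero ℤ.- corner a b c d σ′ zero) ℤ.+ β ℤ.* (corner a b c d σ (suc zero) ℤ.- corner a b c d σ′ (suc zero))
corner-difference-spans a b c d {zero}             {zero}             σ≢σ′ = ⊥-elim (σ≢σ′ refl)
corner-difference-spans a b c d {suc zero}         {suc zero}         σ≢σ′ = ⊥-elim (σ≢σ′ refl)
corner-difference-spans a b c d {suc (suc zero)}   {suc (suc zero)}   σ≢σ′ = ⊥-elim (σ≢σ′ refl)
corner-difference-spans a b c d {zero}             {suc zero}         _ = ℤ.- d , c , identity a b c d
  where identity : ∀ a b c d → a ℤ.* d ℤ.- b ℤ.* c ≡ ℤ.- d ℤ.* (0ℤ ℤ.- a) ℤ.+ c ℤ.* (0ℤ ℤ.- b)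
        identity = solve-∀
corner-difference-spans a b c d {suc zero}         {zero}             _ = d , ℤ.- c , identity a b c d
  where identity : ∀ a b c d → a ℤ.* d ℤ.- b ℤ.* c ≡ d ℤ.* (a ℤ.- 0ℤ) ℤ.+ ℤ.- c ℤ.* (b ℤ.- 0ℤ)
        identity = solve-∀
corner-difference-spans a b c d {zero}             {suc (suc zero)}   _ = b , ℤ.- a , identity a b c d
  where identity : ∀ a b c d → a ℤ.* d ℤ.- b ℤ.* c ≡ b ℤ.* (0ℤ ℤ.- c) ℤ.+ ℤ.- a ℤ.* (0ℤ ℤ.- d)
        identity = solve-∀
corner-difference-spans a b c d {suc (suc zero)}   {zero}             _ = ℤ.- b , a , identity a b c d
  where identity : ∀ a b c d → a ℤ.* d ℤ.- b ℤ.* c ≡ ℤ.- b ℤ.* (c ℤ.- 0ℤ) ℤ.+ a ℤ.* (d ℤ.- 0ℤ)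
        identity = solve-∀
corner-difference-spans a b c d {suc zero}         {suc (suc zero)}   _ = b , ℤ.- a , identity a b c d
  where identity : ∀ a b c d → a ℤ.* d ℤ.- b ℤ.* c ≡ b ℤ.* (a ℤ.- c) ℤ.+ ℤ.- a ℤ.* (b ℤ.- d)
        identity = solve-∀
corner-difference-spans a b c d {suc (suc zero)}   {suc zero}         _ = ℤ.- b , a , identity a b c d
  where identity : ∀ a b c d → a ℤ.* d ℤ.- b ℤ.* c ≡ ℤ.- b ℤ.* (c ℤ.- a) ℤ.+ a ℤ.* (d ℤ.- b)
        identity = solve-∀

corner-injective : ∀ {a b c d} → Nondeg a b c d → ∀ {σ σ′} → (∀ i → corner a b c d σ i ≡ corner a b c d σ′ i) → σ ≡ σ′
corner-injective {a} {b} {c} {d} nd {σ} {σ′} corners-equal with σ FinP.≟ σ′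
... | yes σ≡σ′ = σ≡σ′
... | no σ≢σ′ with corner-difference-spans a b c d σ≢σ′
...   | α , β , det≡ = ⊥-elim (nd (trans det≡ (trans (cong₂ (λ p q → α ℤ.* p ℤ.+ β ℤ.* q) (difference-zero zero) (difference-zero (suc zero)))
                                                      (vanish α β))))
  where
  difference-zero : ∀ i → corner a b c d σ i ℤ.- corner a b c d σ′ i ≡ 0ℤ
  difference-zero i = trans (cong (ℤ._- corner a b c d σ′ i) (corners-equal i)) (ℤP.+-inverseʳ (corner a b c d σ′ i))
  vanish : ∀ α β → α ℤ.* 0ℤ ℤ.+ β ℤ.* 0ℤ ≡ 0ℤ
  vanish = solve-∀

-- Two distinct vertices of Qₙ differ by ±1 in some coordinate unless both lie in the plane triangle,
-- and then their difference is an edge of the triangle, which spans its determinant.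
vertex-difference-∣det : ∀ {m} a b c d {D} {j j′ : Fin (3 + m)} → j ≢ j′ →
  (∀ i → D ∣ vertexℤ a b c d j i ℤ.- vertexℤ a b c d j′ i) → D ∣ det₂ a b c d
vertex-difference-∣det a b c d {D} {j} {j′} j≢j′ D∣j-j′ with corner-or-basis j | corner-or-basis j′
... | inj₂ (u , refl) | _ = subst (D ∣_) (ℤP.*-identityʳ (det₂ a b c d)) (∣n⇒∣m*n (det₂ a b c d) D∣1)
  where
  D∣1 : D ∣ 1ℤ
  D∣1 = subst (D ∣_) (cong₂ ℤ._-_ (I-diag u) (vertexℤ-basis-coordinate a b c d (λ j′≡j → j≢j′ (sym j′≡j)))) (D∣j-j′ (2 ↑ʳ u))
... | inj₁ _ | inj₂ (u , refl) = subst (D ∣_) (ℤP.*-identityʳ (det₂ a b c d)) (∣n⇒∣m*n (det₂ a b c d) D∣1)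
  where
  D∣1 : D ∣ 1ℤ
  D∣1 = ∣m⇒∣-m (subst (D ∣_) (cong₂ ℤ._-_ (vertexℤ-basis-coordinate a b c d j≢j′) (I-diag u)) (D∣j-j′ (2 ↑ʳ u)))
... | inj₁ (σ , refl) | inj₁ (σ′ , refl) with corner-difference-spans a b c d (λ σ≡σ′ → j≢j′ (cong (_↑ˡ _) σ≡σ′))
...   | α , β , det≡ =
  subst (D ∣_) (sym det≡) (∣m∣n⇒∣m+n (∣n⇒∣m*n α (D∣corner-difference zero)) (∣n⇒∣m*n β (D∣corner-difference (suc zero))))
  where
  D∣corner-difference : ∀ i → D ∣ corner a b c d σ i ℤ.- corner a b c d σ′ i
  D∣corner-difference i = subst (D ∣_) (cong₂ ℤ._-_ (vertexℤ-corner a b c d σ i) (vertexℤ-corner a b c d σ′ i)) (D∣j-j′ (i ↑ˡ _))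

-- Extending a planar equivalence to Qₙ

embed : ∀ k → Point 2 → Point (3 + k)
embed k p zero          = p zero
embed k p (suc zero)    = p (suc zero)
embed k p (suc (suc _)) = 0ℚ

Qverts-embed : ∀ k a b c d (σ : Fin 3) → Qverts (3 + k) a b c d (σ ↑ˡ suc k) ≗ embed k (Qverts 2 a b c d σ)
Qverts-embed k a b c d zero             zero          = refl
Qverts-embed k a b c d zero             (suc zero)    = refl
Qverts-embed k a b c d zero             (suc (suc _)) = refl
Qverts-embed k a b c d (suc zero)       zero          = refl
Qverts-embed k a b c d (suc zero)       (suc zero)    = refl
Qverts-embed k a b c d (suc zero)       (suc (suc _)) = refl
Qverts-embed k a b c d (suc (suc zero)) zero          = refl
Qverts-embed k a b c d (suc (suc zero)) (suc zero)    = refl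
Qverts-embed k a b c d (suc (suc zero)) (suc (suc _)) = refl

embed∈conv : ∀ k a b c d {p : Point 2} → conv (Qverts 2 a b c d) p → conv (Qverts (3 + k) a b c d) (embed k p)
embed∈conv k a b c d (L , L≥0 , ΣL≡1 , p≗LV) = L′ , L′≥0 , ΣL′≡1 , embed-p≗L′V
  where
  L′ : Fin (4 + k) → ℚ
  L′ zero                = L zero
  L′ (suc zero)          = L (suc zero)
  L′ (suc (suc zero))    = L (suc (suc zero))
  L′ (suc (suc (suc _))) = 0ℚ
  L′≥0 : ∀ i → 0ℚ ℚ.≤ L′ i
  L′≥0 zero                = L≥0 zero
  L′≥0 (suc zero)          = L≥0 (suc zero)
  L′≥0 (suc (suc zero))    = L≥0 (suc (suc zero))
  L′≥0 (suc (suc (suc _))) = ℚP.≤-refl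
  ΣL′≡1 : Σℚ L′ ≡ 1ℚ
  ΣL′≡1 = trans (cong (λ z → L zero ℚ.+ (L (suc zero) ℚ.+ (L (suc (suc zero)) ℚ.+ z))) (Σℚ-zero {suc k} {λ _ → 0ℚ} (λ _ → refl))) ΣL≡1
  embed-p≗L′V : embed k _ ≗ combination L′ (Qverts (3 + k) a b c d)
  embed-p≗L′V zero          = trans (p≗LV zero) (trans (combination-Qverts-plane a b c d L zero)
                                (sym (combination-Qverts-plane a b c d L′ zero)))
  embed-p≗L′V (suc zero)    = trans (p≗LV (suc zero)) (trans (combination-Qverts-plane a b c d L (suc zero))
                                (sym (combination-Qverts-plane a b c d L′ (suc zero))))
  embed-p≗L′V (suc (suc u)) = sym (combination-Qverts-tail a b c d L′ u)

embed-resp-≗ : ∀ k {p q : Point 2} → p ≗ q → embed k p ≗ embed k q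
embed-resp-≗ k p≗q zero          = p≗q zero
embed-resp-≗ k p≗q (suc zero)    = p≗q (suc zero)
embed-resp-≗ k p≗q (suc (suc _)) = refl

-- The block matrix [[M, v ⋯ v], [0, I]]. With v = −c and the translation (c, 0) it acts on the plane
-- as x ↦ M x + c and fixes every basis vector eᵢ, i ≥ 3.
shear : ∀ k → Mat 2 → (Fin 2 → ℤ) → Mat (3 + k)
shear k M v zero          zero          = M zero zero
shear k M v zero          (suc zero)    = M zero (suc zero)
shear k M v (suc zero)    zero          = M (suc zero) zero
shear k M v (suc zero)    (suc zero)    = M (suc zero) (suc zero)
shear k M v zero          (suc (suc _)) = v zero
shear k M v (suc zero)    (suc (suc _)) = v (suc zero)
shear k M v (suc (suc _)) zero          = 0ℤ
shear k M v (suc (suc _)) (suc zero)    = 0ℤ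
shear k M v (suc (suc u)) (suc (suc t)) = I u t

shift : ∀ k → (Fin 2 → ℤ) → Fin (3 + k) → ℤ
shift k v zero          = v zero
shift k v (suc zero)    = v (suc zero)
shift k v (suc (suc _)) = 0ℤ

shear-⊗ : ∀ k {M M′ : Mat 2} {v v′ : Fin 2 → ℤ} → (∀ i j → (M ⊗ M′) i j ≡ I i j) → (∀ i → (M *ᵥ v′) i ℤ.+ v i ≡ 0ℤ) →
  ∀ i j → (shear k M v ⊗ shear k M′ v′) i j ≡ I i j
shear-⊗ k {M} {M′} {v} {v′} MM′≡I Mv′+v≡0 = entry
  where
  plane : ∀ i j → M i zero ℤ.* M′ zero j ℤ.+ (M i (suc zero) ℤ.* M′ (suc zero) j ℤ.+ Σℤ (λ (_ : Fin (suc k)) → v i ℤ.* 0ℤ)) ≡ I i j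
  plane i j = trans (cong (λ w → M i zero ℤ.* M′ zero j ℤ.+ (M i (suc zero) ℤ.* M′ (suc zero) j ℤ.+ w))
                          (Σℤ-zero {suc k} (λ _ → ℤP.*-zeroʳ (v i))))
                    (MM′≡I i j)
  column : ∀ i (t : Fin (suc k)) → M i zero ℤ.* v′ zero ℤ.+ (M i (suc zero) ℤ.* v′ (suc zero) ℤ.+ Σℤ (λ s → v i ℤ.* I s t)) ≡ 0ℤ
  column i t = begin
    x₀ ℤ.* y₀ ℤ.+ (x₁ ℤ.* y₁ ℤ.+ Σℤ (λ s → v i ℤ.* I s t))  ≡⟨ cong (λ w → x₀ ℤ.* y₀ ℤ.+ (x₁ ℤ.* y₁ ℤ.+ w)) (Σℤ-I-col (v i) t) ⟩
    x₀ ℤ.* y₀ ℤ.+ (x₁ ℤ.* y₁ ℤ.+ v i)                      ≡⟨ regroup x₀ x₁ y₀ y₁ (v i) ⟩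
    x₀ ℤ.* y₀ ℤ.+ (x₁ ℤ.* y₁ ℤ.+ 0ℤ) ℤ.+ v i                ≡⟨ Mv′+v≡0 i ⟩
    0ℤ                                                     ∎
    where
    open ≡-Reasoning
    x₀ = M i zero
    x₁ = M i (suc zero)
    y₀ = v′ zero
    y₁ = v′ (suc zero)
    regroup : ∀ x₀ x₁ y₀ y₁ u → x₀ ℤ.* y₀ ℤ.+ (x₁ ℤ.* y₁ ℤ.+ u) ≡ x₀ ℤ.* y₀ ℤ.+ (x₁ ℤ.* y₁ ℤ.+ 0ℤ) ℤ.+ u
    regroup = solve-∀
  lower : ∀ {e} y₀ y₁ (f : Fin (suc k) → ℤ) → Σℤ f ≡ e → 0ℤ ℤ.* y₀ ℤ.+ (0ℤ ℤ.* y₁ ℤ.+ Σℤ f) ≡ e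
  lower y₀ y₁ f Σf≡e = trans (cong₂ (λ p q → p ℤ.+ (q ℤ.+ Σℤ f)) (ℤP.*-zeroˡ y₀) (ℤP.*-zeroˡ y₁))
    (trans (ℤP.+-identityˡ (0ℤ ℤ.+ Σℤ f)) (trans (ℤP.+-identityˡ (Σℤ f)) Σf≡e))
  entry : ∀ i j → (shear k M v ⊗ shear k M′ v′) i j ≡ I i j
  entry zero          zero          = plane zero zero
  entry zero          (suc zero)    = plane zero (suc zero)
  entry (suc zero)    zero          = plane (suc zero) zero
  entry (suc zero)    (suc zero)    = plane (suc zero) (suc zero)
  entry zero          (suc (suc t)) = column zero t
  entry (suc zero)    (suc (suc t)) = column (suc zero) t
  entry (suc (suc u)) zero          = lower (M′ zero zero) (M′ (suc zero) zero) (λ s → I u s ℤ.* 0ℤ) (Σℤ-zero (λ s → ℤP.*-zeroʳ (I u s)))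
  entry (suc (suc u)) (suc zero)    = lower (M′ zero (suc zero)) (M′ (suc zero) (suc zero)) (λ s → I u s ℤ.* 0ℤ) (Σℤ-zero (λ s → ℤP.*-zeroʳ (I u s)))
  entry (suc (suc u)) (suc (suc t)) = lower (v′ zero) (v′ (suc zero)) (λ s → I u s ℤ.* I s t)
    (trans (Σℤ-select u (λ s → I s t)) (sym (trans (I-suc (suc u) (suc t)) (I-suc u t))))

shear-embed : ∀ k (B : Mat 2) (t : Fin 2 → ℤ) (p : Point 2) →
  affine (shear k B (λ i → ℤ.- t i)) (shift k t) (embed k p) ≗ embed k (affine B t p)
shear-embed k B t p zero          = cong (λ w → ℤtoℚ (B zero zero) ℚ.* p zero ℚ.+ (ℤtoℚ (B zero (suc zero)) ℚ.* p (suc zero) ℚ.+ w) ℚ.+ ℤtoℚ (t zero))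
                                     (Σℚ-zero {suc k} (λ _ → ℚP.*-zeroʳ (ℤtoℚ (ℤ.- t zero))))
shear-embed k B t p (suc zero)    = cong (λ w → ℤtoℚ (B (suc zero) zero) ℚ.* p zero ℚ.+ (ℤtoℚ (B (suc zero) (suc zero)) ℚ.* p (suc zero) ℚ.+ w) ℚ.+ ℤtoℚ (t (suc zero)))
                                     (Σℚ-zero {suc k} (λ _ → ℚP.*-zeroʳ (ℤtoℚ (ℤ.- t (suc zero)))))
shear-embed k B t p (suc (suc u)) = begin
  0ℚ ℚ.* p zero ℚ.+ (0ℚ ℚ.* p (suc zero) ℚ.+ Σℚ (λ s → ℤtoℚ (I u s) ℚ.* 0ℚ)) ℚ.+ 0ℚ
    ≡⟨ cong₂ (λ x y → x ℚ.+ (y ℚ.+ Σℚ (λ s → ℤtoℚ (I u s) ℚ.* 0ℚ)) ℚ.+ 0ℚ) (ℚP.*-zeroˡ (p zero)) (ℚP.*-zeroˡ (p (suc zero))) ⟩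
  0ℚ ℚ.+ (0ℚ ℚ.+ Σℚ (λ s → ℤtoℚ (I u s) ℚ.* 0ℚ)) ℚ.+ 0ℚ
    ≡⟨ cong (λ w → 0ℚ ℚ.+ (0ℚ ℚ.+ w) ℚ.+ 0ℚ) (Σℚ-zero (λ s → ℚP.*-zeroʳ (ℤtoℚ (I u s)))) ⟩
  0ℚ
    ∎
  where open ≡-Reasoning

shear-basis : ∀ k a b c d a′ b′ c′ d′ (B : Mat 2) (t : Fin 2 → ℤ) (u : Fin (suc k)) →
  affine (shear k B (λ i → ℤ.- t i)) (shift k t) (Qverts (3 + k) a b c d (3 ↑ʳ u)) ≗ Qverts (3 + k) a′ b′ c′ d′ (3 ↑ʳ u)
shear-basis k a b c d a′ b′ c′ d′ B t u i =
  trans (affine-integral (shear k B (λ i → ℤ.- t i)) (shift k t) (vertexℤ a b c d (3 ↑ʳ u)) (Qverts-integral a b c d (3 ↑ʳ u)) i)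
        (trans (cong ℤtoℚ (fixes-basis i)) (sym (Qverts-integral a′ b′ c′ d′ (3 ↑ʳ u) i)))
  where
  cancel : ∀ x y t → x ℤ.* 0ℤ ℤ.+ (y ℤ.* 0ℤ ℤ.+ ℤ.- t) ℤ.+ t ≡ 0ℤ
  cancel = solve-∀
  keep : ∀ x → 0ℤ ℤ.* 0ℤ ℤ.+ (0ℤ ℤ.* 0ℤ ℤ.+ x) ℤ.+ 0ℤ ≡ x
  keep = solve-∀
  fixes-basis : ∀ i → (shear k B (λ i → ℤ.- t i) *ᵥ vertexℤ a b c d (3 ↑ʳ u)) i ℤ.+ shift k t i ≡ vertexℤ a′ b′ c′ d′ (3 ↑ʳ u) i
  fixes-basis zero          = trans (cong (λ w → B zero zero ℤ.* 0ℤ ℤ.+ (B zero (suc zero) ℤ.* 0ℤ ℤ.+ w) ℤ.+ t zero) (Σℤ-I-row (ℤ.- t zero) u))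
                                    (cancel (B zero zero) (B zero (suc zero)) (t zero))
  fixes-basis (suc zero)    = trans (cong (λ w → B (suc zero) zero ℤ.* 0ℤ ℤ.+ (B (suc zero) (suc zero) ℤ.* 0ℤ ℤ.+ w) ℤ.+ t (suc zero)) (Σℤ-I-row (ℤ.- t (suc zero)) u))
                                    (cancel (B (suc zero) zero) (B (suc zero) (suc zero)) (t (suc zero)))
  fixes-basis (suc (suc w)) = trans (cong (λ x → 0ℤ ℤ.* 0ℤ ℤ.+ (0ℤ ℤ.* 0ℤ ℤ.+ x) ℤ.+ 0ℤ) (Σℤ-select w (I u))) (keep (I u w))

extend : ∀ k {a b c d a′ b′ c′ d′} → UnimodEquiv (Qpoly 2 a b c d) (Qpoly 2 a′ b′ c′ d′) →
  UnimodEquiv (Qpoly (3 + k) a b c d) (Qpoly (3 + k) a′ b′ c′ d′)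
extend k {a} {b} {c} {d} {a′} {b′} {c′} {d′} (B , t , (C , BC , CB) , E) =
  unimodEquiv-intro {V = Qverts (3 + k) a b c d} {Qverts (3 + k) a′ b′ c′ d′} Bₙ (shift k t) Bₙ∈GL vertex-image vertex-preimage
  where
  V₂ = Qverts 2 a b c d
  W₂ = Qverts 2 a′ b′ c′ d′
  Vₙ = Qverts (3 + k) a b c d
  Wₙ = Qverts (3 + k) a′ b′ c′ d′
  f₂ = affine B t
  Bₙ = shear k B (λ i → ℤ.- t i)
  fₙ = affine Bₙ (shift k t)
  BCt≡t : ∀ i → (B *ᵥ (C *ᵥ t)) i ℤ.+ ℤ.- t i ≡ 0ℤ
  BCt≡t i = trans (cong (ℤ._+ ℤ.- t i) (trans (*ᵥ-assoc B C t i) (trans (Σℤ-cong (λ l → cong (ℤ._* t l) (BC i l))) (I-*ᵥ t i))))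
                  (ℤP.+-inverseʳ (t i))
  C-t≡-Ct : ∀ i → (C *ᵥ (λ l → ℤ.- t l)) i ℤ.+ (C *ᵥ t) i ≡ 0ℤ
  C-t≡-Ct i = trans (cong (ℤ._+ (C *ᵥ t) i) (*ᵥ-neg C t i)) (ℤP.+-inverseˡ ((C *ᵥ t) i))
  Bₙ∈GL : InGL Bₙ
  Bₙ∈GL = shear k C (C *ᵥ t) , shear-⊗ k BC BCt≡t , shear-⊗ k CB C-t≡-Ct
  triangle-image : ∀ σ → conv Wₙ (fₙ (Vₙ (σ ↑ˡ suc k)))
  triangle-image σ = conv-resp-≗ {V = Wₙ} fₙVₙσ≗embed
    (embed∈conv k a′ b′ c′ d′ (Equivalence.from (E (f₂ (V₂ σ))) (V₂ σ , vertex∈conv V₂ σ , λ _ → refl)))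
    where
    fₙVₙσ≗embed : embed k (f₂ (V₂ σ)) ≗ fₙ (Vₙ (σ ↑ˡ suc k))
    fₙVₙσ≗embed i = sym (trans (affine-resp-≗ Bₙ (shift k t) (Qverts-embed k a b c d σ) i) (shear-embed k B t (V₂ σ) i))
  vertex-image : ∀ s → conv Wₙ (fₙ (Vₙ s))
  vertex-image zero                = triangle-image zero
  vertex-image (suc zero)          = triangle-image (suc zero)
  vertex-image (suc (suc zero))    = triangle-image (suc (suc zero))
  vertex-image (suc (suc (suc u))) = conv-resp-≗ {V = Wₙ} (λ i → sym (shear-basis k a b c d a′ b′ c′ d′ B t u i)) (vertex∈conv Wₙ (3 ↑ʳ u))
  triangle-preimage : ∀ σ → Σ (Point (3 + k)) λ v → conv Vₙ v × fₙ v ≗ Wₙ (σ ↑ˡ suc k)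
  triangle-preimage σ with Equivalence.to (E (W₂ σ)) (vertex∈conv W₂ σ)
  ... | v , v∈V₂ , f₂v≗W₂σ = embed k v , embed∈conv k a b c d v∈V₂ , λ i →
    trans (shear-embed k B t v i) (trans (embed-resp-≗ k f₂v≗W₂σ i) (sym (Qverts-embed k a′ b′ c′ d′ σ i)))
  vertex-preimage : ∀ s → Σ (Point (3 + k)) λ v → conv Vₙ v × fₙ v ≗ Wₙ s
  vertex-preimage zero                = triangle-preimage zero
  vertex-preimage (suc zero)          = triangle-preimage (suc zero)
  vertex-preimage (suc (suc zero))    = triangle-preimage (suc (suc zero))
  vertex-preimage (suc (suc (suc u))) = Vₙ (3 ↑ʳ u) , vertex∈conv Vₙ (3 ↑ʳ u) , shear-basis k a b c d a′ b′ c′ d′ B t u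

-- Triangles with a vertex at height one

S : ℤ → Fin 3 → Point 2
S D = Qverts 2 D 0ℤ 0ℤ 1ℤ

height : ℤ → ℤ → ℤ → (Fin 2 → ℤ) → ℤ
height R₀ R₁ γ p = R₀ ℤ.* p zero ℤ.+ R₁ ℤ.* p (suc zero) ℤ.+ γ

height-difference : ∀ R₀ R₁ γ (x y : Fin 2 → ℤ) →
  height R₀ R₁ γ y ℤ.- height R₀ R₁ γ x ≡ R₀ ℤ.* (y zero ℤ.- x zero) ℤ.+ R₁ ℤ.* (y (suc zero) ℤ.- x (suc zero))
height-difference R₀ R₁ γ x y = expand R₀ R₁ γ (x zero) (x (suc zero)) (y zero) (y (suc zero))
  where
  expand : ∀ R₀ R₁ γ x₀ x₁ y₀ y₁ →
    (R₀ ℤ.* y₀ ℤ.+ R₁ ℤ.* y₁ ℤ.+ γ) ℤ.- (R₀ ℤ.* x₀ ℤ.+ R₁ ℤ.* x₁ ℤ.+ γ) ≡ R₀ ℤ.* (y₀ ℤ.- x₀) ℤ.+ R₁ ℤ.* (y₁ ℤ.- x₁)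
  expand = solve-∀

orientation : (x y z : Fin 2 → ℤ) → ℤ
orientation x y z = det₂ (y zero ℤ.- x zero) (z zero ℤ.- x zero) (y (suc zero) ℤ.- x (suc zero)) (z (suc zero) ℤ.- x (suc zero))

-- If an integral affine functional vanishes at x and y and equals 1 at z, then y − x is
-- orientation x y z times the primitive vector (R₁, −R₀) along the kernel of its linear part.
base-edge : ∀ {R₀ R₁ γ} (x y z : Fin 2 → ℤ) → height R₀ R₁ γ x ≡ 0ℤ → height R₀ R₁ γ y ≡ 0ℤ → height R₀ R₁ γ z ≡ 1ℤ →
  y zero ℤ.- x zero ≡ orientation x y z ℤ.* R₁ × y (suc zero) ℤ.- x (suc zero) ≡ orientation x y z ℤ.* ℤ.- R₀
base-edge {R₀} {R₁} {γ} x y z hx≡0 hy≡0 hz≡1 = first-coordinate , second-coordinate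
  where
  open ≡-Reasoning
  w₀ = y zero ℤ.- x zero
  w₁ = y (suc zero) ℤ.- x (suc zero)
  e₀ = z zero ℤ.- x zero
  e₁ = z (suc zero) ℤ.- x (suc zero)
  ℓw≡0 : R₀ ℤ.* w₀ ℤ.+ R₁ ℤ.* w₁ ≡ 0ℤ
  ℓw≡0 = trans (sym (height-difference R₀ R₁ γ x y)) (cong₂ ℤ._-_ hy≡0 hx≡0)
  ℓe≡1 : R₀ ℤ.* e₀ ℤ.+ R₁ ℤ.* e₁ ≡ 1ℤ
  ℓe≡1 = trans (sym (height-difference R₀ R₁ γ x z)) (cong₂ ℤ._-_ hz≡1 hx≡0)
  unit-combination : ∀ u v → u ≡ u ℤ.* 1ℤ ℤ.- v ℤ.* 0ℤ
  unit-combination = solve-∀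
  cramer₀ : ∀ R₀ R₁ w₀ w₁ e₀ e₁ →
    w₀ ℤ.* (R₀ ℤ.* e₀ ℤ.+ R₁ ℤ.* e₁) ℤ.- e₀ ℤ.* (R₀ ℤ.* w₀ ℤ.+ R₁ ℤ.* w₁) ≡ (w₀ ℤ.* e₁ ℤ.- e₀ ℤ.* w₁) ℤ.* R₁
  cramer₀ = solve-∀
  cramer₁ : ∀ R₀ R₁ w₀ w₁ e₀ e₁ →
    w₁ ℤ.* (R₀ ℤ.* e₀ ℤ.+ R₁ ℤ.* e₁) ℤ.- e₁ ℤ.* (R₀ ℤ.* w₀ ℤ.+ R₁ ℤ.* w₁) ≡ (w₀ ℤ.* e₁ ℤ.- e₀ ℤ.* w₁) ℤ.* ℤ.- R₀
  cramer₁ = solve-∀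
  first-coordinate : w₀ ≡ orientation x y z ℤ.* R₁
  first-coordinate = begin
    w₀                                                                    ≡⟨ unit-combination w₀ e₀ ⟩
    w₀ ℤ.* 1ℤ ℤ.- e₀ ℤ.* 0ℤ                                               ≡⟨ cong₂ (λ p q → w₀ ℤ.* p ℤ.- e₀ ℤ.* q) ℓe≡1 ℓw≡0 ⟨
    w₀ ℤ.* (R₀ ℤ.* e₀ ℤ.+ R₁ ℤ.* e₁) ℤ.- e₀ ℤ.* (R₀ ℤ.* w₀ ℤ.+ R₁ ℤ.* w₁)  ≡⟨ cramer₀ R₀ R₁ w₀ w₁ e₀ e₁ ⟩
    orientation x y z ℤ.* R₁                                              ∎
  second-coordinate : w₁ ≡ orientation x y z ℤ.* ℤ.- R₀
  second-coordinate = begin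
    w₁                                                                    ≡⟨ unit-combination w₁ e₁ ⟩
    w₁ ℤ.* 1ℤ ℤ.- e₁ ℤ.* 0ℤ                                               ≡⟨ cong₂ (λ p q → w₁ ℤ.* p ℤ.- e₁ ℤ.* q) ℓe≡1 ℓw≡0 ⟨
    w₁ ℤ.* (R₀ ℤ.* e₀ ℤ.+ R₁ ℤ.* e₁) ℤ.- e₁ ℤ.* (R₀ ℤ.* w₀ ℤ.+ R₁ ℤ.* w₁)  ≡⟨ cramer₁ R₀ R₁ w₀ w₁ e₀ e₁ ⟩
    orientation x y z ℤ.* ℤ.- R₀                                          ∎

-- With x, y, z = P 0, P 1, P 2 and E = orientation x y z, the affine map with linear part
-- [σ (R₁, −R₀) | z − x] and translation x sends the vertices 0, (σ E, 0), (0, 1) of S(σ E) to x, y, z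
-- (by base-edge); its determinant is σ times the height of z above x, that is σ.
S≅triangle : ∀ {V : Fin 3 → Point 2} (P : Fin 3 → Fin 2 → ℤ) (ρ : Fin 3 → Fin 3) → (∀ s → ∃ λ τ → ρ τ ≡ s) →
  (∀ τ → V (ρ τ) ≗ λ i → ℤtoℚ (P τ i)) →
  ∀ {R₀ R₁ γ} → height R₀ R₁ γ (P zero) ≡ 0ℤ → height R₀ R₁ γ (P (suc zero)) ≡ 0ℤ → height R₀ R₁ γ (P (suc (suc zero))) ≡ 1ℤ →
  ∀ {σ} → σ ℤ.* σ ≡ 1ℤ → UnimodEquiv (conv (S (σ ℤ.* orientation (P zero) (P (suc zero)) (P (suc (suc zero)))))) (conv V)
S≅triangle {V} P ρ ρ-surjective Vρ≗P {R₀} {R₁} {γ} hx≡0 hy≡0 hz≡1 {σ} σ²≡1 =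
  unimodEquiv-of-vertices {V = S (σ ℤ.* E)} {V} M x M∈GL ρ corner-images ρ-surjective
  where
  open ≡-Reasoning
  x = P zero
  y = P (suc zero)
  z = P (suc (suc zero))
  E = orientation x y z
  e₀ = z zero ℤ.- x zero
  e₁ = z (suc zero) ℤ.- x (suc zero)
  M = mat₂ (σ ℤ.* R₁) e₀ (σ ℤ.* ℤ.- R₀) e₁
  ℓe≡1 : R₀ ℤ.* e₀ ℤ.+ R₁ ℤ.* e₁ ≡ 1ℤ
  ℓe≡1 = trans (sym (height-difference R₀ R₁ γ x z)) (cong₂ ℤ._-_ hz≡1 hx≡0)
  detM≡σ : det₂ (σ ℤ.* R₁) e₀ (σ ℤ.* ℤ.- R₀) e₁ ≡ σ
  detM≡σ = trans (factor σ R₁ R₀ e₀ e₁) (trans (cong (σ ℤ.*_) ℓe≡1) (ℤP.*-identityʳ σ))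
    where
    factor : ∀ σ R₁ R₀ e₀ e₁ → σ ℤ.* R₁ ℤ.* e₁ ℤ.- e₀ ℤ.* (σ ℤ.* ℤ.- R₀) ≡ σ ℤ.* (R₀ ℤ.* e₀ ℤ.+ R₁ ℤ.* e₁)
    factor = solve-∀
  M∈GL : InGL M
  M∈GL = InGL₂ _ _ _ _ (trans (cong₂ ℤ._*_ detM≡σ detM≡σ) σ²≡1)
  origin : ∀ p q u → p ℤ.* 0ℤ ℤ.+ (q ℤ.* 0ℤ ℤ.+ 0ℤ) ℤ.+ u ≡ u
  origin = solve-∀
  apex : ∀ p u v → p ℤ.* 0ℤ ℤ.+ ((v ℤ.- u) ℤ.* 1ℤ ℤ.+ 0ℤ) ℤ.+ u ≡ v
  apex = solve-∀
  far-end : ∀ {R c u v} → v ℤ.- u ≡ E ℤ.* R → σ ℤ.* R ℤ.* (σ ℤ.* E) ℤ.+ (c ℤ.* 0ℤ ℤ.+ 0ℤ) ℤ.+ u ≡ v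
  far-end {R} {c} {u} {v} v-u≡ER = begin
    σ ℤ.* R ℤ.* (σ ℤ.* E) ℤ.+ (c ℤ.* 0ℤ ℤ.+ 0ℤ) ℤ.+ u  ≡⟨ regroup σ R E c u ⟩
    σ ℤ.* σ ℤ.* (E ℤ.* R) ℤ.+ u                         ≡⟨ cong₂ (λ p q → p ℤ.* q ℤ.+ u) σ²≡1 (sym v-u≡ER) ⟩
    1ℤ ℤ.* (v ℤ.- u) ℤ.+ u                              ≡⟨ restore u v ⟩
    v                                                   ∎
    where
    regroup : ∀ σ R E c u → σ ℤ.* R ℤ.* (σ ℤ.* E) ℤ.+ (c ℤ.* 0ℤ ℤ.+ 0ℤ) ℤ.+ u ≡ σ ℤ.* σ ℤ.* (E ℤ.* R) ℤ.+ u
    regroup = solve-∀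
    restore : ∀ u v → 1ℤ ℤ.* (v ℤ.- u) ℤ.+ u ≡ v
    restore = solve-∀
  integral : ∀ τ i → (M *ᵥ corner (σ ℤ.* E) 0ℤ 0ℤ 1ℤ τ) i ℤ.+ x i ≡ P τ i
  integral zero             zero       = origin (σ ℤ.* R₁) e₀ (x zero)
  integral zero             (suc zero) = origin (σ ℤ.* ℤ.- R₀) e₁ (x (suc zero))
  integral (suc zero)       zero       = far-end {R₁} {e₀} (proj₁ (base-edge {R₀} {R₁} {γ} x y z hx≡0 hy≡0 hz≡1))
  integral (suc zero)       (suc zero) = far-end {ℤ.- R₀} {e₁} (proj₂ (base-edge {R₀} {R₁} {γ} x y z hx≡0 hy≡0 hz≡1))
  integral (suc (suc zero)) zero       = apex (σ ℤ.* R₁) (x zero) (z zero)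
  integral (suc (suc zero)) (suc zero) = apex (σ ℤ.* ℤ.- R₀) (x (suc zero)) (z (suc zero))
  corner-images : ∀ τ → affine M x (S (σ ℤ.* E) τ) ≗ V (ρ τ)
  corner-images τ i = trans (affine-integral M x (corner (σ ℤ.* E) 0ℤ 0ℤ 1ℤ τ) (Qverts-integral (σ ℤ.* E) 0ℤ 0ℤ 1ℤ τ) i)
                            (trans (cong ℤtoℚ (integral τ i)) (sym (Vρ≗P τ i)))

height-vanishing : ∀ {a b c d R₀ R₁ γ} → Nondeg a b c d → (∀ σ → height R₀ R₁ γ (corner a b c d σ) ≡ 0ℤ) → R₀ ≡ 0ℤ × R₁ ≡ 0ℤ
height-vanishing {a} {b} {c} {d} {R₀} {R₁} {γ} nd vanishes =
  det-cancel {a} {b} {c} {d} nd (trans (eliminate-R₁ a b c d R₀ R₁ γ) (heights-zero d b (d ℤ.- b))) ,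
  det-cancel {a} {b} {c} {d} nd (trans (eliminate-R₀ a b c d R₀ R₁ γ) (heights-zero (ℤ.- c) (ℤ.- a) (a ℤ.- c)))
  where
  heights-zero : ∀ x y z → x ℤ.* height R₀ R₁ γ (corner a b c d (suc zero)) ℤ.- y ℤ.* height R₀ R₁ γ (corner a b c d (suc (suc zero)))
                             ℤ.- z ℤ.* height R₀ R₁ γ (corner a b c d zero) ≡ 0ℤ
  heights-zero x y z = trans
    (cong₂ ℤ._-_ (cong₂ (λ p q → x ℤ.* p ℤ.- y ℤ.* q) (vanishes (suc zero)) (vanishes (suc (suc zero)))) (cong (z ℤ.*_) (vanishes zero)))
    (vanish x y z)
    where
    vanish : ∀ x y z → x ℤ.* 0ℤ ℤ.- y ℤ.* 0ℤ ℤ.- z ℤ.* 0ℤ ≡ 0ℤ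
    vanish = solve-∀
  eliminate-R₁ : ∀ a b c d R₀ R₁ γ → (a ℤ.* d ℤ.- b ℤ.* c) ℤ.* R₀ ≡
    d ℤ.* (R₀ ℤ.* a ℤ.+ R₁ ℤ.* b ℤ.+ γ) ℤ.- b ℤ.* (R₀ ℤ.* c ℤ.+ R₁ ℤ.* d ℤ.+ γ) ℤ.- (d ℤ.- b) ℤ.* (R₀ ℤ.* 0ℤ ℤ.+ R₁ ℤ.* 0ℤ ℤ.+ γ)
  eliminate-R₁ = solve-∀
  eliminate-R₀ : ∀ a b c d R₀ R₁ γ → (a ℤ.* d ℤ.- b ℤ.* c) ℤ.* R₁ ≡
    ℤ.- c ℤ.* (R₀ ℤ.* a ℤ.+ R₁ ℤ.* b ℤ.+ γ) ℤ.- ℤ.- a ℤ.* (R₀ ℤ.* c ℤ.+ R₁ ℤ.* d ℤ.+ γ) ℤ.- (a ℤ.- c) ℤ.* (R₀ ℤ.* 0ℤ ℤ.+ R₁ ℤ.* 0ℤ ℤ.+ γ)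
  eliminate-R₀ = solve-∀

sign-to-abs : ∀ D → ∃ λ σ → σ ℤ.* σ ≡ 1ℤ × σ ℤ.* D ≡ ℤ.+ ℤ.∣ D ∣
sign-to-abs D with ℤP.+∣i∣≡i⊎+∣i∣≡-i D
... | inj₁ ∣D∣≡D  = 1ℤ , refl , trans (ℤP.*-identityˡ D) (sym ∣D∣≡D)
... | inj₂ ∣D∣≡-D = -1ℤ , refl , trans (ℤP.-1*i≡-i D) (sym ∣D∣≡-D)

next : Fin 3 → Fin 3
next zero             = suc zero
next (suc zero)       = suc (suc zero)
next (suc (suc zero)) = zero

rotation : Fin 3 → Fin 3 → Fin 3
rotation s zero             = next s
rotation s (suc zero)       = next (next s)
rotation s (suc (suc zero)) = s

rotation-surjective : ∀ s t → ∃ λ τ → rotation s τ ≡ t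
rotation-surjective zero             zero             = suc (suc zero) , refl
rotation-surjective zero             (suc zero)       = zero , refl
rotation-surjective zero             (suc (suc zero)) = suc zero , refl
rotation-surjective (suc zero)       zero             = suc zero , refl
rotation-surjective (suc zero)       (suc zero)       = suc (suc zero) , refl
rotation-surjective (suc zero)       (suc (suc zero)) = zero , refl
rotation-surjective (suc (suc zero)) zero             = zero , refl
rotation-surjective (suc (suc zero)) (suc zero)       = suc zero , refl
rotation-surjective (suc (suc zero)) (suc (suc zero)) = suc (suc zero) , refl

rotation-distinct : ∀ s → rotation s zero ≢ s × rotation s (suc zero) ≢ s × rotation s (suc zero) ≢ rotation s zero
rotation-distinct zero             = (λ ()) , (λ ()) , (λ ())
rotation-distinct (suc zero)       = (λ ()) , (λ ()) , (λ ())
rotation-distinct (suc (suc zero)) = (λ ()) , (λ ()) , (λ ())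

rotation-orientation : ∀ a b c d s →
  orientation (corner a b c d (rotation s zero)) (corner a b c d (rotation s (suc zero))) (corner a b c d (rotation s (suc (suc zero))))
  ≡ det₂ a b c d
rotation-orientation a b c d zero             = identity a b c d
  where identity : ∀ a b c d → (c ℤ.- a) ℤ.* (0ℤ ℤ.- b) ℤ.- (0ℤ ℤ.- a) ℤ.* (d ℤ.- b) ≡ a ℤ.* d ℤ.- b ℤ.* c
        identity = solve-∀
rotation-orientation a b c d (suc zero)       = identity a b c d
  where identity : ∀ a b c d → (0ℤ ℤ.- c) ℤ.* (b ℤ.- d) ℤ.- (a ℤ.- c) ℤ.* (0ℤ ℤ.- d) ≡ a ℤ.* d ℤ.- b ℤ.* c
        identity = solve-∀
rotation-orientation a b c d (suc (suc zero)) = identity a b c d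
  where identity : ∀ a b c d → (a ℤ.- 0ℤ) ℤ.* (d ℤ.- 0ℤ) ℤ.- (c ℤ.- 0ℤ) ℤ.* (b ℤ.- 0ℤ) ≡ a ℤ.* d ℤ.- b ℤ.* c
        identity = solve-∀

plane-or-basis : ∀ {n} (g : Fin 3 → Fin (3 + n)) →
  (Σ (Fin 3 → Fin 3) λ π → ∀ σ → g σ ≡ π σ ↑ˡ n) ⊎ (∃₂ λ s u → g s ≡ 3 ↑ʳ u)
plane-or-basis g with corner-or-basis (g zero) | corner-or-basis (g (suc zero)) | corner-or-basis (g (suc (suc zero)))
... | inj₂ (u , eq) | _             | _             = inj₂ (zero , u , eq)
... | inj₁ _        | inj₂ (u , eq) | _             = inj₂ (suc zero , u , eq)
... | inj₁ _        | inj₁ _        | inj₂ (u , eq) = inj₂ (suc (suc zero) , u , eq)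
... | inj₁ (σ₀ , eq₀) | inj₁ (σ₁ , eq₁) | inj₁ (σ₂ , eq₂) = inj₁ (π , g≡π)
  where
  π : Fin 3 → Fin 3
  π zero             = σ₀
  π (suc zero)       = σ₁
  π (suc (suc zero)) = σ₂
  g≡π : ∀ σ → g σ ≡ π σ ↑ˡ _
  g≡π zero             = eq₀
  g≡π (suc zero)       = eq₁
  g≡π (suc (suc zero)) = eq₂

-- Restricting an equivalence of Qₙ to the plane

PlanarOrApex : ℤ → ℤ → ℤ → ℤ → ℤ → ℤ → ℤ → ℤ → Set
PlanarOrApex a b c d a′ b′ c′ d′ = UnimodEquiv (Qpoly 2 a b c d) (Qpoly 2 a′ b′ c′ d′) ⊎
  (UnimodEquiv (conv (S (ℤ.+ ℤ.∣ det₂ a b c d ∣))) (Qpoly 2 a b c d) × det₂ a b c d ∣ det₂ a′ b′ c′ d′)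

module Descent {k} {a b c d a′ b′ c′ d′ : ℤ} (nd : Nondeg a b c d) (B : Mat (3 + k)) (t : Fin (3 + k) → ℤ) (B∈GL : InGL B)
  (E : ∀ y → Qpoly (3 + k) a′ b′ c′ d′ y ⇔ (Σ (Point (3 + k)) λ v → Qpoly (3 + k) a b c d v × affine B t v ≗ y)) where

  Vₙ = Qverts (3 + k) a b c d
  Wₙ = Qverts (3 + k) a′ b′ c′ d′
  D = det₂ a b c d
  D′ = det₂ a′ b′ c′ d′

  corner-image : ∀ σ → ∃ λ j → affine B t (Vₙ (σ ↑ˡ suc k)) ≗ Wₙ j
  corner-image σ = extreme↦vertex {V = Vₙ} {Wₙ} B t B∈GL E (σ ↑ˡ suc k) (corner-extreme a b c d nd σ)

  image : Fin 3 → Fin (4 + k)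
  image σ = proj₁ (corner-image σ)

  image-injective : ∀ {σ σ′} → image σ ≡ image σ′ → σ ≡ σ′
  image-injective {σ} {σ′} image-eq = corner-injective nd λ i → ℤtoℚ-injective (begin
    ℤtoℚ (corner a b c d σ i)
      ≡⟨ cong ℤtoℚ (vertexℤ-corner a b c d σ i) ⟨
    ℤtoℚ (vertexℤ a b c d (σ ↑ˡ suc k) (i ↑ˡ suc k))
      ≡⟨ Qverts-integral a b c d (σ ↑ˡ suc k) (i ↑ˡ suc k) ⟨
    Vₙ (σ ↑ˡ suc k) (i ↑ˡ suc k)
      ≡⟨ affine-injective {B = B} t B∈GL {Vₙ (σ ↑ˡ suc k)} {Vₙ (σ′ ↑ˡ suc k)} same-image (i ↑ˡ suc k) ⟩
    Vₙ (σ′ ↑ˡ suc k) (i ↑ˡ suc k)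
      ≡⟨ Qverts-integral a b c d (σ′ ↑ˡ suc k) (i ↑ˡ suc k) ⟩
    ℤtoℚ (vertexℤ a b c d (σ′ ↑ˡ suc k) (i ↑ˡ suc k))
      ≡⟨ cong ℤtoℚ (vertexℤ-corner a b c d σ′ i) ⟩
    ℤtoℚ (corner a b c d σ′ i)
      ∎)
    where
    open ≡-Reasoning
    same-image : affine B t (Vₙ (σ ↑ˡ suc k)) ≗ affine B t (Vₙ (σ′ ↑ˡ suc k))
    same-image r = trans (proj₂ (corner-image σ) r) (trans (cong (λ j → Wₙ j r) image-eq) (sym (proj₂ (corner-image σ′) r)))

  row : ∀ σ r → height (B r zero) (B r (suc zero)) (t r) (corner a b c d σ) ≡ vertexℤ a′ b′ c′ d′ (image σ) r
  row σ r = ℤtoℚ-injective (begin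
    ℤtoℚ (height (B r zero) (B r (suc zero)) (t r) (corner a b c d σ))
      ≡⟨ cong (λ z → ℤtoℚ (z ℤ.+ t r)) (*ᵥ-corner a b c d B σ r) ⟨
    ℤtoℚ ((B *ᵥ vertexℤ a b c d (σ ↑ˡ suc k)) r ℤ.+ t r)
      ≡⟨ affine-integral B t (vertexℤ a b c d (σ ↑ˡ suc k)) (Qverts-integral a b c d (σ ↑ˡ suc k)) r ⟨
    affine B t (Vₙ (σ ↑ˡ suc k)) r
      ≡⟨ proj₂ (corner-image σ) r ⟩
    Wₙ (image σ) r
      ≡⟨ Qverts-integral a′ b′ c′ d′ (image σ) r ⟩
    ℤtoℚ (vertexℤ a′ b′ c′ d′ (image σ) r)
      ∎)
    where open ≡-Reasoning

  -- The eᵤ-coordinate of the map is an integral affine functional on the plane which is 1 at the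
  -- corner s sent to eᵤ and 0 at the other two corners: s lies at height one over the opposite edge.
  apex-case : ∀ s u → image s ≡ 3 ↑ʳ u → UnimodEquiv (conv (S (ℤ.+ ℤ.∣ D ∣))) (Qpoly 2 a b c d) × D ∣ D′
  apex-case s u image-s≡eᵤ = S≅T , D∣D′
    where
    r = 2 ↑ʳ u
    R₀ = B r zero
    R₁ = B r (suc zero)
    γ = t r
    x = corner a b c d (rotation s zero)
    y = corner a b c d (rotation s (suc zero))
    z = corner a b c d (rotation s (suc (suc zero)))
    at-apex : height R₀ R₁ γ z ≡ 1ℤ
    at-apex = trans (row s r) (trans (cong (λ j → vertexℤ a′ b′ c′ d′ j r) image-s≡eᵤ) (I-diag u))
    off-apex : ∀ {σ} → σ ≢ s → height R₀ R₁ γ (corner a b c d σ) ≡ 0ℤ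
    off-apex {σ} σ≢s = trans (row σ r) (vertexℤ-basis-coordinate a′ b′ c′ d′ (λ eq → σ≢s (image-injective (trans eq (sym image-s≡eᵤ)))))
    distinct = rotation-distinct s
    at-x = off-apex (proj₁ distinct)
    at-y = off-apex (proj₁ (proj₂ distinct))
    sign = sign-to-abs D
    S≅T : UnimodEquiv (conv (S (ℤ.+ ℤ.∣ D ∣))) (Qpoly 2 a b c d)
    S≅T = subst (λ e → UnimodEquiv (conv (S e)) (Qpoly 2 a b c d))
            (trans (cong (proj₁ sign ℤ.*_) (rotation-orientation a b c d s)) (proj₂ (proj₂ sign)))
            (S≅triangle {V = Qverts 2 a b c d} (λ τ → corner a b c d (rotation s τ)) (rotation s) (rotation-surjective s)
               (λ τ → Qverts-integral a b c d (rotation s τ)) {R₀} {R₁} {γ} at-x at-y at-apex {proj₁ sign} (proj₁ (proj₂ sign)))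
    edge = base-edge {R₀} {R₁} {γ} x y z at-x at-y at-apex
    multiple-of-D : ∀ {w R} → w ≡ orientation x y z ℤ.* R → D ∣ w
    multiple-of-D {w} {R} w≡ = divides R (trans w≡ (trans (cong (ℤ._* R) (rotation-orientation a b c d s)) (ℤP.*-comm D R)))
    D∣edge-image : ∀ i → D ∣ vertexℤ a′ b′ c′ d′ (image (rotation s (suc zero))) i ℤ.- vertexℤ a′ b′ c′ d′ (image (rotation s zero)) i
    D∣edge-image i = subst (D ∣_) edge-image
      (∣m∣n⇒∣m+n (∣n⇒∣m*n (B i zero) (multiple-of-D (proj₁ edge))) (∣n⇒∣m*n (B i (suc zero)) (multiple-of-D (proj₂ edge))))
      where
      edge-image : B i zero ℤ.* (y zero ℤ.- x zero) ℤ.+ B i (suc zero) ℤ.* (y (suc zero) ℤ.- x (suc zero)) ≡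
                   vertexℤ a′ b′ c′ d′ (image (rotation s (suc zero))) i ℤ.- vertexℤ a′ b′ c′ d′ (image (rotation s zero)) i
      edge-image = trans (sym (height-difference (B i zero) (B i (suc zero)) (t i) x y))
                     (cong₂ ℤ._-_ (row (rotation s (suc zero)) i) (row (rotation s zero) i))
    D∣D′ : D ∣ D′
    D∣D′ = vertex-difference-∣det a′ b′ c′ d′ (λ eq → proj₂ (proj₂ distinct) (image-injective eq)) D∣edge-image

  module Planar (π : Fin 3 → Fin 3) (image≡π : ∀ σ → image σ ≡ π σ ↑ˡ suc k) where

    lower-left-vanishes : ∀ u → B (2 ↑ʳ u) zero ≡ 0ℤ × B (2 ↑ʳ u) (suc zero) ≡ 0ℤ
    lower-left-vanishes u = height-vanishing nd λ σ →
      trans (row σ (2 ↑ʳ u)) (trans (cong (λ j → vertexℤ a′ b′ c′ d′ j (2 ↑ʳ u)) (image≡π σ)) (vertexℤ-corner-tail a′ b′ c′ d′ (π σ) u))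

    B₂ : Mat 2
    B₂ = mat₂ (B zero zero) (B zero (suc zero)) (B (suc zero) zero) (B (suc zero) (suc zero))

    t₂ : Fin 2 → ℤ
    t₂ i = t (i ↑ˡ suc k)

    -- With the lower-left block of B zero, the top-left block of C is a left inverse of B₂.
    B₂∈GL : InGL B₂
    B₂∈GL = left-inverse⇒InGL₂ C₂ C₂B₂≡I
      where
      C = proj₁ B∈GL
      C₂ : Mat 2
      C₂ i j = C (i ↑ˡ suc k) (j ↑ˡ suc k)
      restricted-inverse : ∀ i j → (∀ u → B (2 ↑ʳ u) (j ↑ˡ suc k) ≡ 0ℤ) →
        C₂ i zero ℤ.* B zero (j ↑ˡ suc k) ℤ.+ (C₂ i (suc zero) ℤ.* B (suc zero) (j ↑ˡ suc k) ℤ.+ 0ℤ) ≡ I i j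
      restricted-inverse i j column-vanishes = trans
        (cong (λ w → C₂ i zero ℤ.* B zero (j ↑ˡ suc k) ℤ.+ (C₂ i (suc zero) ℤ.* B (suc zero) (j ↑ˡ suc k) ℤ.+ w))
          (sym (Σℤ-zero (λ u → trans (cong (C (i ↑ˡ suc k) (2 ↑ʳ u) ℤ.*_) (column-vanishes u))
                                     (ℤP.*-zeroʳ (C (i ↑ˡ suc k) (2 ↑ʳ u)))))))
        (trans (proj₂ (proj₂ B∈GL) (i ↑ˡ suc k) (j ↑ˡ suc k)) (I-↑ˡ (suc k) i j))
      C₂B₂≡I : ∀ i j → (C₂ ⊗ B₂) i j ≡ I i j
      C₂B₂≡I zero       zero       = restricted-inverse zero zero (λ u → proj₁ (lower-left-vanishes u))
      C₂B₂≡I zero       (suc zero) = restricted-inverse zero (suc zero) (λ u → proj₂ (lower-left-vanishes u))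
      C₂B₂≡I (suc zero) zero       = restricted-inverse (suc zero) zero (λ u → proj₁ (lower-left-vanishes u))
      C₂B₂≡I (suc zero) (suc zero) = restricted-inverse (suc zero) (suc zero) (λ u → proj₂ (lower-left-vanishes u))

    corner-images : ∀ σ → affine B₂ t₂ (Qverts 2 a b c d σ) ≗ Qverts 2 a′ b′ c′ d′ (π σ)
    corner-images σ i = trans (affine-integral B₂ t₂ (corner a b c d σ) (Qverts-integral a b c d σ) i)
                              (trans (cong ℤtoℚ (integral i)) (sym (Qverts-integral a′ b′ c′ d′ (π σ) i)))
      where
      plane-row : ∀ i → B (i ↑ˡ suc k) zero ℤ.* corner a b c d σ zero ℤ.+ (B (i ↑ˡ suc k) (suc zero) ℤ.* corner a b c d σ (suc zero) ℤ.+ 0ℤ)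
                          ℤ.+ t (i ↑ˡ suc k) ≡ corner a′ b′ c′ d′ (π σ) i
      plane-row i = trans (cong (λ w → B (i ↑ˡ suc k) zero ℤ.* corner a b c d σ zero ℤ.+ w ℤ.+ t (i ↑ˡ suc k)) (ℤP.+-identityʳ _))
        (trans (row σ (i ↑ˡ suc k)) (trans (cong (λ j → vertexℤ a′ b′ c′ d′ j (i ↑ˡ suc k)) (image≡π σ)) (vertexℤ-corner a′ b′ c′ d′ (π σ) i)))
      integral : ∀ i → (B₂ *ᵥ corner a b c d σ) i ℤ.+ t₂ i ≡ corner a′ b′ c′ d′ (π σ) i
      integral zero       = plane-row zero
      integral (suc zero) = plane-row (suc zero)

    π-surjective : ∀ τ → ∃ λ σ → π σ ≡ τ
    π-surjective = injective⇒surjective π λ πσ≡πσ′ →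
      image-injective (trans (image≡π _) (trans (cong (_↑ˡ suc k) πσ≡πσ′) (sym (image≡π _))))

    planar-case : UnimodEquiv (Qpoly 2 a b c d) (Qpoly 2 a′ b′ c′ d′)
    planar-case = unimodEquiv-of-vertices {V = Qverts 2 a b c d} {Qverts 2 a′ b′ c′ d′} B₂ t₂ B₂∈GL π corner-images π-surjective

  planar-or-apex : PlanarOrApex a b c d a′ b′ c′ d′
  planar-or-apex = Sum.map (λ (π , image≡π) → Planar.planar-case π image≡π) (λ (s , u , image-s≡eᵤ) → apex-case s u image-s≡eᵤ)
                           (plane-or-basis image)

descend : ∀ {k a b c d a′ b′ c′ d′} → Nondeg a b c d → UnimodEquiv (Qpoly (3 + k) a b c d) (Qpoly (3 + k) a′ b′ c′ d′) →
  PlanarOrApex a b c d a′ b′ c′ d′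
descend nd (B , t , B∈GL , E) = Descent.planar-or-apex nd B t B∈GL E

combine-descents : ∀ {a b c d a′ b′ c′ d′} → PlanarOrApex a b c d a′ b′ c′ d′ → PlanarOrApex a′ b′ c′ d′ a b c d →
  UnimodEquiv (Qpoly 2 a b c d) (Qpoly 2 a′ b′ c′ d′)
combine-descents (inj₁ T≅T′) _ = T≅T′
combine-descents {a} {b} {c} {d} {a′} {b′} {c′} {d′} (inj₂ _) (inj₁ T′≅T) =
  unimodEquiv-sym {V = Qverts 2 a′ b′ c′ d′} {Qverts 2 a b c d} T′≅T
combine-descents {a} {b} {c} {d} {a′} {b′} {c′} {d′} (inj₂ (S≅T , D∣D′)) (inj₂ (S′≅T′ , D′∣D)) =
  unimodEquiv-trans {U = Qverts 2 a b c d} {S (ℤ.+ ℤ.∣ det₂ a b c d ∣)} {Qverts 2 a′ b′ c′ d′}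
    (unimodEquiv-sym {V = S (ℤ.+ ℤ.∣ det₂ a b c d ∣)} {Qverts 2 a b c d} S≅T)
    (subst (λ n → UnimodEquiv (conv (S (ℤ.+ n))) (Qpoly 2 a′ b′ c′ d′)) (ℕ∣.∣-antisym (∣⇒∣ᵤ D′∣D) (∣⇒∣ᵤ D∣D′)) S′≅T′)

theorem4p1 : (a b c d a′ b′ c′ d′ : ℤ) → Nondeg a b c d → Nondeg a′ b′ c′ d′ →
    (n : ℕ) → 2 < n →
    UnimodEquiv (Qpoly 2 a b c d) (Qpoly 2 a′ b′ c′ d′) ⇔
      UnimodEquiv (Qpoly n a b c d) (Qpoly n a′ b′ c′ d′)
theorem4p1 a b c d a′ b′ c′ d′ nd nd′ (suc (suc (suc k))) (ℕ.s≤s (ℕ.s≤s (ℕ.s≤s ℕ.z≤n))) =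
  mk⇔ (extend k) λ Qₙ≅Q′ₙ →
    combine-descents (descend nd Qₙ≅Q′ₙ) (descend nd′ (unimodEquiv-sym {V = Qverts (3 + k) a b c d} {Qverts (3 + k) a′ b′ c′ d′} Qₙ≅Q′ₙ))
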